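{- Let $\mathbb{K}$ be a field of characteristic $0$ and $A=\{a_1<a_2<\cdots\}$ a countable totally ordered alphabet. Equip $\mathbb{K}\langle A\rangle^+$ with the dendriform trialgebra structure given, for nonempty words $u,v\in A^*$, by $u\succ v=uv$ if $\max(u)<\max(v)$ and $0$ otherwise, $u\circ v=uv$ if $\max(u)=\max(v)$ and $0$ otherwise, $u\prec v=uv$ if $\max(u)>\max(v)$ and $0$ otherwise (extended bilinearly). Let $\mathfrak{T}$ be the sub-trialgebra of $\mathbb{K}\langle A\rangle^+$ generated by $M_1=\sum_{i\ge 1}a_i$. Then $\mathfrak{T}$ is free as a dendriform trialgebra (on the generator $M_1$): the unique morphism of dendriform trialgebras from the free dendriform trialgebra on one generator $x$ to $\mathfrak{T}$ sending $x$ to $M_1$ is an isomorphism.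
   Context: $A^*$ is the free monoid on $A$; $\mathbb{K}\langle A\rangle$ denotes the (graded) inverse limit $\varprojlim \mathbb{K}\langle A_n\rangle$, with $A_n=\{a_1,\dots,a_n\}$ and $\mathbb{K}\langle A_n\rangle$ the free associative algebra on $A_n$; its homogeneous elements of degree $d$ are arbitrary formal linear combinations of words of length $d$; $\mathbb{K}\langle A\rangle^+$ is the ideal of elements without constant term. For a nonempty word $w$, $\max(w)$ is the largest letter of $w$. A dendriform trialgebra is a vector space with three bilinear operations $\prec,\circ,\succ$ such that, writing $x\cdot y=x\prec y+x\circ y+x\succ y$, $\circ$ is associative and $(x\prec y)\prec z=x\prec(y\cdot z)$, $(x\succ y)\prec z=x\succ(y\prec z)$, $(x\cdot y)\succ z=x\succ(y\succ z)$, $(x\succ y)\circ z=x\succ(y\circ z)$, $(x\prec y)\circ z=x\circ(y\succ z)$, $(x\circ y)\prec z=x\circ(y\prec z)$. Morphisms preserve the three operations; the sub-trialgebra generated by an element is the smallest subspace containing it and closed under the three operations; the free dendriform trialgebra on one generator is the initial such object equipped with a distinguished element. -}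

module Defs where

open import Level using (Level; _⊔_) renaming (suc to lsuc)
open import Algebra.Bundles using (CommutativeRing)
open import Data.Nat as ℕ using (ℕ; zero; suc; _<ᵇ_; _≡ᵇ_)
open import Data.Bool using (Bool; true; false; if_then_else_)
open import Data.List using (List; []; _∷_; [_]; map; foldr)
open import Data.Product using (_×_; _,_; Σ; ∃)
open import Relation.Nullary using (¬_)

record Field (c ℓ : Level) : Set (lsuc (c ⊔ ℓ)) where
  field
    commutativeRing : CommutativeRing c ℓ
  open CommutativeRing commutativeRing public
  field
    1≉0     : ¬ (1# ≈ 0#)
    inverse : ∀ x → ¬ (x ≈ 0#) → ∃ λ y → (x * y) ≈ 1#

module _ {c ℓ} (F : Field c ℓ) where
  open Field F
  natCast : ℕ → Carrier
  natCast zero    = 0#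
  natCast (suc n) = 1# + natCast n

CharZero : ∀ {c ℓ} → Field c ℓ → Set ℓ
CharZero F = ∀ n → ¬ (Field._≈_ F (natCast F (suc n)) (Field.0# F))

module Construction {c ℓ} (F : Field c ℓ) where
  open Field F

  -- The free dendriform trialgebra over K on one generator x:
  -- formal expressions modulo the least K-linear congruence containing
  -- the vector space axioms, bilinearity of ≺, ∘, ≻ and the 7
  -- trialgebra axioms.

  infixl 6 _⊕_
  infixr 7 _⊛_
  infixl 8 _≺_ _⊚_ _≻_

  data Tm : Set c where
    gen  : Tm
    nil  : Tm
    _⊕_  : Tm → Tm → Tm
    _⊛_  : Carrier → Tm → Tm
    _≺_  : Tm → Tm → Tm
    _⊚_  : Tm → Tm → Tm
    _≻_  : Tm → Tm → Tm

  _·_ : Tm → Tm → Tm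
  x · y = x ≺ y ⊕ x ⊚ y ⊕ x ≻ y

  infix 4 _~_
  data _~_ : Tm → Tm → Set (c ⊔ ℓ) where
    ~refl  : ∀ {s} → s ~ s
    ~sym   : ∀ {s t} → s ~ t → t ~ s
    ~trans : ∀ {s t u} → s ~ t → t ~ u → s ~ u
    ⊕-cong : ∀ {s s′ t t′} → s ~ s′ → t ~ t′ → s ⊕ t ~ s′ ⊕ t′
    ⊛-cong : ∀ {a b s t} → a ≈ b → s ~ t → a ⊛ s ~ b ⊛ t
    ≺-cong : ∀ {s s′ t t′} → s ~ s′ → t ~ t′ → s ≺ t ~ s′ ≺ t′
    ⊚-cong : ∀ {s s′ t t′} → s ~ s′ → t ~ t′ → s ⊚ t ~ s′ ⊚ t′
    ≻-cong : ∀ {s s′ t t′} → s ~ s′ → t ~ t′ → s ≻ t ~ s′ ≻ t′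
    ⊕-assoc  : ∀ s t u → (s ⊕ t) ⊕ u ~ s ⊕ (t ⊕ u)
    ⊕-comm   : ∀ s t → s ⊕ t ~ t ⊕ s
    ⊕-idˡ    : ∀ s → nil ⊕ s ~ s
    ⊕-inv    : ∀ s → (- 1#) ⊛ s ⊕ s ~ nil
    ⊛-one    : ∀ s → 1# ⊛ s ~ s
    ⊛-assoc  : ∀ a b s → (a * b) ⊛ s ~ a ⊛ (b ⊛ s)
    ⊛-distʳ  : ∀ a s t → a ⊛ (s ⊕ t) ~ a ⊛ s ⊕ a ⊛ t
    ⊛-distˡ  : ∀ a b s → (a + b) ⊛ s ~ a ⊛ s ⊕ b ⊛ s
    ≺-⊕ˡ : ∀ s t u → (s ⊕ t) ≺ u ~ s ≺ u ⊕ t ≺ u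
    ≺-⊕ʳ : ∀ s t u → s ≺ (t ⊕ u) ~ s ≺ t ⊕ s ≺ u
    ≺-⊛ˡ : ∀ a s t → (a ⊛ s) ≺ t ~ a ⊛ (s ≺ t)
    ≺-⊛ʳ : ∀ a s t → s ≺ (a ⊛ t) ~ a ⊛ (s ≺ t)
    ⊚-⊕ˡ : ∀ s t u → (s ⊕ t) ⊚ u ~ s ⊚ u ⊕ t ⊚ u
    ⊚-⊕ʳ : ∀ s t u → s ⊚ (t ⊕ u) ~ s ⊚ t ⊕ s ⊚ u
    ⊚-⊛ˡ : ∀ a s t → (a ⊛ s) ⊚ t ~ a ⊛ (s ⊚ t)
    ⊚-⊛ʳ : ∀ a s t → s ⊚ (a ⊛ t) ~ a ⊛ (s ⊚ t)
    ≻-⊕ˡ : ∀ s t u → (s ⊕ t) ≻ u ~ s ≻ u ⊕ t ≻ u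
    ≻-⊕ʳ : ∀ s t u → s ≻ (t ⊕ u) ~ s ≻ t ⊕ s ≻ u
    ≻-⊛ˡ : ∀ a s t → (a ⊛ s) ≻ t ~ a ⊛ (s ≻ t)
    ≻-⊛ʳ : ∀ a s t → s ≻ (a ⊛ t) ~ a ⊛ (s ≻ t)
    ⊚-assoc : ∀ x y z → (x ⊚ y) ⊚ z ~ x ⊚ (y ⊚ z)
    ax1 : ∀ x y z → (x ≺ y) ≺ z ~ x ≺ (y · z)
    ax2 : ∀ x y z → (x ≻ y) ≺ z ~ x ≻ (y ≺ z)
    ax3 : ∀ x y z → (x · y) ≻ z ~ x ≻ (y ≻ z)
    ax4 : ∀ x y z → (x ≻ y) ⊚ z ~ x ≻ (y ⊚ z)
    ax5 : ∀ x y z → (x ≺ y) ⊚ z ~ x ⊚ (y ≻ z)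
    ax6 : ∀ x y z → (x ⊚ y) ≺ z ~ x ⊚ (y ≺ z)

  -- K⟨A⟩ : formal series, i.e. functions from words to K.
  -- Alphabet A = ℕ with the letter n standing for a_{n+1} (order preserved).

  Word : Set
  Word = List ℕ

  Ser : Set c
  Ser = Word → Carrier

  _≐_ : Ser → Ser → Set ℓ
  f ≐ g = ∀ w → f w ≈ g w

  -- max of a word (only used on nonempty words, where it is the largest letter)
  maxL : Word → ℕ
  maxL = foldr ℕ._⊔_ 0

  splits : Word → List (Word × Word)
  splits []            = []
  splits (x ∷ [])      = []
  splits (x ∷ y ∷ r)   =
    ([ x ] , y ∷ r) ∷ map (λ { (u , v) → (x ∷ u , v) }) (splits (y ∷ r))

  sumK : List Carrier → Carrier
  sumK = foldr _+_ 0#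

  mulWith : (ℕ → ℕ → Bool) → Ser → Ser → Ser
  mulWith test f g w =
    sumK (map (λ { (u , v) → if test (maxL u) (maxL v) then f u * g v else 0# })
              (splits w))

  _≺S_ _⊚S_ _≻S_ : Ser → Ser → Ser
  _≺S_ = mulWith (λ m n → n <ᵇ m)
  _⊚S_ = mulWith (λ m n → m ≡ᵇ n)
  _≻S_ = mulWith (λ m n → m <ᵇ n)

  _⊕S_ : Ser → Ser → Ser
  (f ⊕S g) w = f w + g w

  _⊛S_ : Carrier → Ser → Ser
  (a ⊛S f) w = a * f w

  zeroS : Ser
  zeroS _ = 0#

  M₁ : Ser
  M₁ (x ∷ []) = 1#
  M₁ _        = 0#

  φ : Tm → Ser
  φ gen     = M₁
  φ nil     = zeroS
  φ (s ⊕ t) = φ s ⊕S φ t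
  φ (a ⊛ s) = a ⊛S φ s
  φ (s ≺ t) = φ s ≺S φ t
  φ (s ⊚ t) = φ s ⊚S φ t
  φ (s ≻ t) = φ s ≻S φ t

  data In𝔗 : Ser → Set (c ⊔ ℓ) where
    𝔗-M₁   : In𝔗 M₁
    𝔗-zero : In𝔗 zeroS
    𝔗-⊕    : ∀ {f g} → In𝔗 f → In𝔗 g → In𝔗 (f ⊕S g)
    𝔗-⊛    : ∀ {f} a → In𝔗 f → In𝔗 (a ⊛S f)
    𝔗-≺    : ∀ {f g} → In𝔗 f → In𝔗 g → In𝔗 (f ≺S g)
    𝔗-⊚    : ∀ {f g} → In𝔗 f → In𝔗 g → In𝔗 (f ⊚S g)
    𝔗-≻    : ∀ {f g} → In𝔗 f → In𝔗 g → In𝔗 (f ≻S g)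
    𝔗-resp : ∀ {f g} → f ≐ g → In𝔗 f → In𝔗 g

module Submission where

-- Expanding both sides of a trialgebra
-- axiom over the factorisations w = x y z, the two sides keep the same terms: this is a
-- statement about the triple (max x, max y, max z).
--
-- The axioms rewrite every element of the free trialgebra as a linear combination of trees
-- T₀ ≻ (Z₁ ∘ ⋯ ∘ Zₖ) with atoms Zᵢ equal to x or x ≺ T. The image of a tree is the
-- characteristic series of a set of words; the shape of a tree forces where its factorisations
-- split a word (at the first occurrence of the largest letter, or after the first letter
-- followed by letters below it), so the sets of distinct trees are disjoint, and each contains
-- a witness word. Evaluating at witnesses reads off coefficients, so a combination with zero
-- image is zero.

open import Defs
open import Level using (_⊔_)
import Algebra.Properties.CommutativeSemigroup as CommutativeSemigroupProperties
import Algebra.Properties.Ring as RingProperties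
open import Data.Bool using (Bool; true; false; if_then_else_; _∧_; _∨_; T)
open import Data.Bool.Properties using (∧-zeroʳ; ∧-identityʳ; T-∧; T-∨)
open import Data.Empty using (⊥; ⊥-elim)
open import Data.List using (List; []; _∷_; [_]; map; foldr; _++_; concatMap; length; filter)
open import Data.List.Properties
  using (map-∘; ∷-injective; filter-accept; filter-reject; length-filter)
open import Data.List.Relation.Unary.All as All using (All; []; _∷_)
import Data.List.Relation.Unary.All.Properties as All
open import Data.Maybe using (Maybe; just; nothing)
import Data.Nat as ℕ
open import Data.Nat using (ℕ; zero; suc; _≤_; _<_; z≤n; s≤s; _<?_; _<ᵇ_; _≡ᵇ_)
  renaming (_⊔_ to _⊔ⁿ_)
open import Data.Nat.Properties
  using ( ≤-refl; ≤-trans; <⇒≤; ≤-<-trans; <-≤-trans; <-irrefl; n≮n; n<1+n; n≤1+n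
        ; ⊔-assoc; ⊔-idem; ⊔-identityʳ; ⊔-lub; m≤m⊔n; m≤n⊔m; m⊔n≤o⇒m≤o; m⊔n≤o⇒n≤o
        ; m≥n⇒m⊔n≡m; m≤n⇒m⊔n≡n; <ᵇ⇒<; <⇒<ᵇ; ≡ᵇ⇒≡; ≡⇒≡ᵇ )
open import Data.Product using (_×_; _,_; proj₁; ∃)
open import Data.Sum using (inj₁; inj₂; [_,_]′)
open import Data.Unit using (⊤; tt)
open import Function using (_∘_)
open import Function.Bundles using (Equivalence)
open import Relation.Binary.Bundles using (Setoid)
open import Relation.Binary.Definitions using (DecidableEquality)
import Relation.Binary.PropositionalEquality as ≡
open ≡ using (_≡_)
import Relation.Binary.Reasoning.Setoid as SetoidReasoning
open import Relation.Nullary using (¬_; does; yes; no)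
open import Relation.Nullary.Decidable using (dec-true; dec-false; map′; T?; ¬?)

Test : Set
Test = ℕ → ℕ → Bool

test≺ test∘ test≻ : Test
test≺ m n = n <ᵇ m
test∘ m n = m ≡ᵇ n
test≻ m n = m <ᵇ n

data ExactlyOne : Bool → Bool → Bool → Set where
  first  : ExactlyOne true false false
  second : ExactlyOne false true false
  third  : ExactlyOne false false true

tests-exactlyOne : ∀ m n → ExactlyOne (test≺ m n) (test∘ m n) (test≻ m n)
tests-exactlyOne zero    zero    = second
tests-exactlyOne zero    (suc n) = third
tests-exactlyOne (suc m) zero    = first
tests-exactlyOne (suc m) (suc n) = tests-exactlyOne m n

-- Expanded over w = x y z, both sides of an axiom keep the terms satisfying a condition on
-- (max x, max y, max z); each lemma is named after the left-hand side, e.g. ≻≺ for (x ≻ y) ≺ z.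
module _ where
  open ≡ using (refl; trans; sym)

  ≺≺-tests : ∀ a b c → (test≺ (a ⊔ⁿ b) c ∧ test≺ a b) ≡ test≺ a (b ⊔ⁿ c)
  ≺≺-tests zero    b       c       = ∧-zeroʳ _
  ≺≺-tests (suc a) zero    zero    = refl
  ≺≺-tests (suc a) zero    (suc c) = ∧-identityʳ _
  ≺≺-tests (suc a) (suc b) zero    = refl
  ≺≺-tests (suc a) (suc b) (suc c) = ≺≺-tests a b c

  ≻≻-tests : ∀ a b c → test≻ (a ⊔ⁿ b) c ≡ (test≻ a (b ⊔ⁿ c) ∧ test≻ b c)
  ≻≻-tests a       b       zero    = sym (∧-zeroʳ _)
  ≻≻-tests zero    zero    (suc c) = refl
  ≻≻-tests (suc a) zero    (suc c) = sym (∧-identityʳ _)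
  ≻≻-tests zero    (suc b) (suc c) = refl
  ≻≻-tests (suc a) (suc b) (suc c) = ≻≻-tests a b c

  ≻≺-tests : ∀ a b c → (test≺ (a ⊔ⁿ b) c ∧ test≻ a b) ≡ (test≻ a (b ⊔ⁿ c) ∧ test≺ b c)
  ≻≺-tests a       zero    c       = trans (∧-zeroʳ _) (sym (∧-zeroʳ _))
  ≻≺-tests zero    (suc b) zero    = refl
  ≻≺-tests zero    (suc b) (suc c) = ∧-identityʳ _
  ≻≺-tests (suc a) (suc b) zero    = sym (∧-identityʳ _)
  ≻≺-tests (suc a) (suc b) (suc c) = ≻≺-tests a b c

  ≻∘-tests : ∀ a b c → (test∘ (a ⊔ⁿ b) c ∧ test≻ a b) ≡ (test≻ a (b ⊔ⁿ c) ∧ test∘ b c)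
  ≻∘-tests zero    zero    zero    = refl
  ≻∘-tests zero    zero    (suc c) = refl
  ≻∘-tests zero    (suc b) zero    = refl
  ≻∘-tests zero    (suc b) (suc c) = ∧-identityʳ _
  ≻∘-tests (suc a) zero    zero    = refl
  ≻∘-tests (suc a) zero    (suc c) = trans (∧-zeroʳ _) (sym (∧-zeroʳ _))
  ≻∘-tests (suc a) (suc b) zero    = sym (∧-zeroʳ _)
  ≻∘-tests (suc a) (suc b) (suc c) = ≻∘-tests a b c

  ≺∘-tests : ∀ a b c → (test∘ (a ⊔ⁿ b) c ∧ test≺ a b) ≡ (test∘ a (b ⊔ⁿ c) ∧ test≻ b c)
  ≺∘-tests zero    zero    zero    = refl
  ≺∘-tests zero    zero    (suc c) = refl
  ≺∘-tests zero    (suc b) zero    = refl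
  ≺∘-tests zero    (suc b) (suc c) = ∧-zeroʳ _
  ≺∘-tests (suc a) zero    zero    = refl
  ≺∘-tests (suc a) zero    (suc c) = refl
  ≺∘-tests (suc a) (suc b) zero    = sym (∧-zeroʳ _)
  ≺∘-tests (suc a) (suc b) (suc c) = ≺∘-tests a b c

  ∘≺-tests : ∀ a b c → (test≺ (a ⊔ⁿ b) c ∧ test∘ a b) ≡ (test∘ a (b ⊔ⁿ c) ∧ test≺ b c)
  ∘≺-tests zero    zero    zero    = refl
  ∘≺-tests zero    zero    (suc c) = refl
  ∘≺-tests zero    (suc b) zero    = refl
  ∘≺-tests zero    (suc b) (suc c) = ∧-zeroʳ _
  ∘≺-tests (suc a) zero    zero    = refl
  ∘≺-tests (suc a) zero    (suc c) = trans (∧-zeroʳ _) (sym (∧-zeroʳ _))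
  ∘≺-tests (suc a) (suc b) zero    = sym (∧-identityʳ _)
  ∘≺-tests (suc a) (suc b) (suc c) = ∘≺-tests a b c

  ∘∘-tests : ∀ a b c → (test∘ (a ⊔ⁿ b) c ∧ test∘ a b) ≡ (test∘ a (b ⊔ⁿ c) ∧ test∘ b c)
  ∘∘-tests zero    zero    zero    = refl
  ∘∘-tests zero    zero    (suc c) = refl
  ∘∘-tests zero    (suc b) zero    = refl
  ∘∘-tests zero    (suc b) (suc c) = ∧-zeroʳ _
  ∘∘-tests (suc a) zero    zero    = refl
  ∘∘-tests (suc a) zero    (suc c) = refl
  ∘∘-tests (suc a) (suc b) zero    = sym (∧-zeroʳ _)
  ∘∘-tests (suc a) (suc b) (suc c) = ∘∘-tests a b c

++-split-unique : ∀ {a} {X : Set a} (u v u′ v′ : List X) →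
                  u ++ v ≡ u′ ++ v′ → length u ≡ length u′ → u ≡ u′ × v ≡ v′
++-split-unique []      v []       v′ eq      _   = ≡.refl , eq
++-split-unique (x ∷ u) v (x′ ∷ u′) v′ eq len with ∷-injective eq
... | ≡.refl , eq′ with ++-split-unique u v u′ v′ eq′ (≡.cong ℕ.pred len)
...   | ≡.refl , ≡.refl = ≡.refl , ≡.refl

-- Word, maxL and splits live in Construction F, hence the otherwise unused field.
module Words {c ℓ} (F : Field c ℓ) where
  open Construction F using (Word; maxL; splits)

  NonEmpty : Word → Set
  NonEmpty []      = ⊥
  NonEmpty (_ ∷ _) = ⊤

  maxL-++ : ∀ u v → maxL (u ++ v) ≡ maxL u ⊔ⁿ maxL v
  maxL-++ []      v = ≡.refl
  maxL-++ (x ∷ u) v = ≡.trans (≡.cong (x ⊔ⁿ_) (maxL-++ u v)) (≡.sym (⊔-assoc x (maxL u) (maxL v)))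

  IsSplit : Word → Word × Word → Set
  IsSplit w (u , v) = (u ++ v ≡ w) × NonEmpty u × NonEmpty v

  splits-sound : ∀ w → All (IsSplit w) (splits w)
  splits-sound []          = []
  splits-sound (x ∷ [])    = []
  splits-sound (x ∷ y ∷ r) = (≡.refl , tt , tt) ∷ extend (splits (y ∷ r)) (splits-sound (y ∷ r))
    where
    extend : ∀ ps → All (IsSplit (y ∷ r)) ps →
             All (IsSplit (x ∷ y ∷ r)) (map (λ { (u , v) → (x ∷ u , v) }) ps)
    extend []            []                      = []
    extend ((u , v) ∷ ps) ((eq , _ , v≢[]) ∷ oks) = (≡.cong (x ∷_) eq , tt , v≢[]) ∷ extend ps oks

  anySplit : (Word → Word → Bool) → Word → Bool
  anySplit p []          = false
  anySplit p (a ∷ [])    = false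
  anySplit p (a ∷ b ∷ r) = p [ a ] (b ∷ r) ∨ anySplit (λ u v → p (a ∷ u) v) (b ∷ r)

  record Split (p : Word → Word → Bool) (w : Word) : Set where
    constructor split
    field
      {left right}   : Word
      left-nonEmpty  : NonEmpty left
      right-nonEmpty : NonEmpty right
      concatenates   : left ++ right ≡ w
      satisfies      : T (p left right)

  anySplit-intro : ∀ p u v → NonEmpty u → NonEmpty v → T (p u v) → T (anySplit p (u ++ v))
  anySplit-intro p (a ∷ [])     (b ∷ r) _ _ puv = Equivalence.from T-∨ (inj₁ puv)
  anySplit-intro p (a ∷ a′ ∷ u) (b ∷ r) _ _ puv =
    Equivalence.from T-∨ (inj₂ (anySplit-intro (λ u v → p (a ∷ u) v) (a′ ∷ u) (b ∷ r) tt tt puv))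

  anySplit-elim : ∀ p w → T (anySplit p w) → Split p w
  anySplit-elim p (a ∷ b ∷ r) h =
    [ split tt tt ≡.refl , extend ∘ anySplit-elim p′ (b ∷ r) ]′ (Equivalence.to T-∨ h)
    where
    p′ : Word → Word → Bool
    p′ u v = p (a ∷ u) v
    extend : Split p′ (b ∷ r) → Split p (a ∷ b ∷ r)
    extend (split {u} _ v≢[] eq puv) = split {left = a ∷ u} tt v≢[] (≡.cong (a ∷_) eq) puv

  ∷-nonEmpty-length : ∀ a u → NonEmpty u → ¬ length (a ∷ u) ≡ 1
  ∷-nonEmpty-length a (_ ∷ _) _ ()

  concatWith : Test → (Word → Bool) → (Word → Bool) → Word → Bool
  concatWith t p q = anySplit (λ u v → t (maxL u) (maxL v) ∧ (p u ∧ q v))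

  record Factorisation (t : Test) (p q : Word → Bool) (w : Word) : Set where
    constructor factorisation
    field
      {left right}   : Word
      left-nonEmpty  : NonEmpty left
      right-nonEmpty : NonEmpty right
      concatenates   : left ++ right ≡ w
      tested         : T (t (maxL left) (maxL right))
      left-in        : T (p left)
      right-in       : T (q right)

  open Factorisation public using (left; right; left-in; right-in)

  concatWith-intro : ∀ t p q {u v} → NonEmpty u → NonEmpty v →
                     T (t (maxL u) (maxL v)) → T (p u) → T (q v) → T (concatWith t p q (u ++ v))
  concatWith-intro t p q {u} {v} u≢[] v≢[] tuv pu qv =
    anySplit-intro _ u v u≢[] v≢[] (Equivalence.from T-∧ (tuv , Equivalence.from T-∧ (pu , qv)))

  toFactorisation : ∀ {t p q w} → Split (λ u v → t (maxL u) (maxL v) ∧ (p u ∧ q v)) w →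
                    Factorisation t p q w
  toFactorisation (split u≢[] v≢[] eq sat) with Equivalence.to T-∧ sat
  ... | tuv , puqv with Equivalence.to T-∧ puqv
  ...   | pu , qv = factorisation u≢[] v≢[] eq tuv pu qv

  concatWith-elim : ∀ t p q {w} → T (concatWith t p q w) → Factorisation t p q w
  concatWith-elim t p q {w} = toFactorisation ∘ anySplit-elim _ w

  maxL-≤ : ∀ {b} v → All (_≤ b) v → maxL v ≤ b
  maxL-≤ []      []          = z≤n
  maxL-≤ (x ∷ v) (x≤b ∷ v≤b) = ⊔-lub x≤b (maxL-≤ v v≤b)

  ≤-maxL : ∀ v → All (_≤ maxL v) v
  ≤-maxL []      = []
  ≤-maxL (x ∷ v) = m≤m⊔n x (maxL v) ∷ All.map (λ y≤ → ≤-trans y≤ (m≤n⊔m x (maxL v))) (≤-maxL v)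

  HeadIsMax : Word → Set
  HeadIsMax []      = ⊥
  HeadIsMax (b ∷ t) = All (_≤ b) t

  HeadIsStrictMax : Word → Set
  HeadIsStrictMax []      = ⊥
  HeadIsStrictMax (a ∷ t) = All (_< a) t

  strict⇒headIsMax : ∀ {w} → HeadIsStrictMax w → HeadIsMax w
  strict⇒headIsMax {_ ∷ _} = All.map <⇒≤

  strict⇒nonEmpty : ∀ {w} → HeadIsStrictMax w → NonEmpty w
  strict⇒nonEmpty {_ ∷ _} _ = tt

  maxL-headIsMax : ∀ b t → All (_≤ b) t → maxL (b ∷ t) ≡ b
  maxL-headIsMax b t t≤b = m≥n⇒m⊔n≡m (maxL-≤ t t≤b)

  heads-agree : ∀ {a b u t} → All (_< a) u → All (_≤ b) t → maxL (a ∷ u) ≡ maxL (b ∷ t) → a ≡ b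
  heads-agree {a} {b} {u} {t} u<a t≤b max≡ = begin
    a               ≡⟨ maxL-headIsMax a u (All.map <⇒≤ u<a) ⟨
    maxL (a ∷ u)    ≡⟨ max≡ ⟩
    maxL (b ∷ t)    ≡⟨ maxL-headIsMax b t t≤b ⟩
    b               ∎
    where open ≡.≡-Reasoning

  headIsMax-++ : ∀ u v → HeadIsStrictMax u → HeadIsMax v → maxL u ≡ maxL v → HeadIsMax (u ++ v)
  headIsMax-++ (a ∷ u) (b ∷ t) u<a t≤b max≡ with heads-agree u<a t≤b max≡
  ... | ≡.refl = All.++⁺ (All.map <⇒≤ u<a) (≤-refl ∷ t≤b)

  lengthBelow : ℕ → Word → ℕ
  lengthBelow m []      = 0
  lengthBelow m (x ∷ r) = if does (x <? m) then suc (lengthBelow m r) else 0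

  lengthBelow-++ : ∀ m u r → All (_< m) u → lengthBelow m (u ++ m ∷ r) ≡ length u
  lengthBelow-++ m []      r []          rewrite dec-false (m <? m) (n≮n m) = ≡.refl
  lengthBelow-++ m (x ∷ u) r (x<m ∷ u<m) rewrite dec-true (x <? m) x<m =
    ≡.cong suc (lengthBelow-++ m u r u<m)

  firstBlockLength : Word → ℕ
  firstBlockLength []      = 0
  firstBlockLength (a ∷ r) = suc (lengthBelow a r)

  ≻-left-length : ∀ u v {w} → u ++ v ≡ w → T (test≻ (maxL u) (maxL v)) → HeadIsMax v →
                  length u ≡ lengthBelow (maxL w) w
  ≻-left-length u (b ∷ t) ≡.refl u≻v t≤b = begin
    length u                                  ≡⟨ lengthBelow-++ b u t u<b ⟨
    lengthBelow b (u ++ b ∷ t)                ≡⟨ ≡.cong (λ m → lengthBelow m (u ++ b ∷ t)) max-w ⟨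
    lengthBelow (maxL (u ++ b ∷ t)) (u ++ b ∷ t) ∎
    where
    open ≡.≡-Reasoning
    maxL-u<b : maxL u < b
    maxL-u<b = ≡.subst (maxL u <_) (maxL-headIsMax b t t≤b) (<ᵇ⇒< _ _ u≻v)
    u<b : All (_< b) u
    u<b = All.map (λ y≤ → ≤-<-trans y≤ maxL-u<b) (≤-maxL u)
    max-w : maxL (u ++ b ∷ t) ≡ b
    max-w = ≡.trans (maxL-++ u (b ∷ t))
              (≡.trans (≡.cong (maxL u ⊔ⁿ_) (maxL-headIsMax b t t≤b)) (m≤n⇒m⊔n≡n (<⇒≤ maxL-u<b)))

  ∘-left-length : ∀ u v {w} → u ++ v ≡ w → HeadIsStrictMax u → HeadIsMax v → maxL u ≡ maxL v →
                  length u ≡ firstBlockLength w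
  ∘-left-length (a ∷ u) (b ∷ t) ≡.refl u<a t≤b max≡ with heads-agree u<a t≤b max≡
  ... | ≡.refl = ≡.cong suc (≡.sym (lengthBelow-++ a u t u<a))

module Series {c ℓ} (F : Field c ℓ) where
  open Field F
  open Construction F
  open Words F
  open SetoidReasoning setoid
  open RingProperties ring using (-1*x≈-x)
  open CommutativeSemigroupProperties +-commutativeSemigroup using () renaming (interchange to +-interchange)
  open CommutativeSemigroupProperties *-commutativeSemigroup using () renaming (x∙yz≈y∙xz to x*yz≈y*xz)

  ∑ : ∀ {a} {X : Set a} → (X → Carrier) → List X → Carrier
  ∑ f xs = sumK (map f xs)

  when : Bool → Carrier → Carrier
  when b x = if b then x else 0#

  module _ {a} {X : Set a} where

    ∑-cong : ∀ {f g : X → Carrier} xs → (∀ x → f x ≈ g x) → ∑ f xs ≈ ∑ g xs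
    ∑-cong []       f≈g = refl
    ∑-cong (x ∷ xs) f≈g = +-cong (f≈g x) (∑-cong xs f≈g)

    ∑-congᴬ : ∀ {p} {Q : X → Set p} {f g : X → Carrier} xs →
              All Q xs → (∀ x → Q x → f x ≈ g x) → ∑ f xs ≈ ∑ g xs
    ∑-congᴬ []       []         f≈g = refl
    ∑-congᴬ (x ∷ xs) (qx ∷ qxs) f≈g = +-cong (f≈g x qx) (∑-congᴬ xs qxs f≈g)

    ∑-zero : ∀ {f : X → Carrier} xs → (∀ x → f x ≈ 0#) → ∑ f xs ≈ 0#
    ∑-zero []       f≈0 = refl
    ∑-zero (x ∷ xs) f≈0 = trans (+-cong (f≈0 x) (∑-zero xs f≈0)) (+-identityˡ 0#)

    ∑-+ : ∀ (f g : X → Carrier) xs → ∑ (λ x → f x + g x) xs ≈ ∑ f xs + ∑ g xs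
    ∑-+ f g []       = sym (+-identityˡ 0#)
    ∑-+ f g (x ∷ xs) = trans (+-congˡ (∑-+ f g xs)) (+-interchange (f x) (g x) _ _)

    *-∑ : ∀ k (f : X → Carrier) xs → k * ∑ f xs ≈ ∑ (λ x → k * f x) xs
    *-∑ k f []       = zeroʳ k
    *-∑ k f (x ∷ xs) = trans (distribˡ k (f x) _) (+-congˡ (*-∑ k f xs))

    ∑-* : ∀ k (f : X → Carrier) xs → ∑ f xs * k ≈ ∑ (λ x → f x * k) xs
    ∑-* k f []       = zeroˡ k
    ∑-* k f (x ∷ xs) = trans (distribʳ k (f x) _) (+-congˡ (∑-* k f xs))

    when-∑ : ∀ b (f : X → Carrier) xs → when b (∑ f xs) ≈ ∑ (λ x → when b (f x)) xs
    when-∑ true  f xs = refl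
    when-∑ false f xs = sym (∑-zero xs (λ _ → refl))

  when-cong : ∀ b {x y} → x ≈ y → when b x ≈ when b y
  when-cong true  x≈y = x≈y
  when-cong false x≈y = refl

  when-+ : ∀ b x y → when b (x + y) ≈ when b x + when b y
  when-+ true  x y = refl
  when-+ false x y = sym (+-identityˡ 0#)

  when-*ˡ : ∀ b x y → when b (x * y) ≈ x * when b y
  when-*ˡ true  x y = refl
  when-*ˡ false x y = sym (zeroʳ x)

  when-*ʳ : ∀ b x y → when b (x * y) ≈ when b x * y
  when-*ʳ true  x y = refl
  when-*ʳ false x y = sym (zeroˡ y)

  when-when : ∀ b d x → when b (when d x) ≈ when (b ∧ d) x
  when-when true  d x = refl
  when-when false d x = refl

  ∑-splits-∷ : ∀ a p → NonEmpty p → (G : Word × Word → Carrier) →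
               ∑ G (splits (a ∷ p)) ≈ G ([ a ] , p) + ∑ (λ (u , v) → G (a ∷ u , v)) (splits p)
  ∑-splits-∷ a (b ∷ r) _ G = +-congˡ (reflexive (≡.cong sumK (≡.sym (map-∘ (splits (b ∷ r))))))

  -- Both sides sum G over all factorisations w = x y z into three nonempty words.
  ∑-splits-assoc : ∀ w (G : Word → Word → Word → Carrier) →
    ∑ (λ (p , z) → ∑ (λ (x , y) → G x y z) (splits p)) (splits w) ≈
    ∑ (λ (x , q) → ∑ (λ (y , z) → G x y z) (splits q)) (splits w)
  ∑-splits-assoc []          G = refl
  ∑-splits-assoc (a ∷ [])    G = refl
  ∑-splits-assoc (a ∷ w@(_ ∷ _)) G = begin
    ∑ (λ (p , z) → ∑ (λ (x , y) → G x y z) (splits p)) (splits (a ∷ w))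
      ≈⟨ +-congˡ (reflexive (≡.cong sumK (≡.sym (map-∘ (splits w))))) ⟩
    0# + ∑ (λ (p , z) → ∑ (λ (x , y) → G x y z) (splits (a ∷ p))) (splits w)
      ≈⟨ +-identityˡ _ ⟩
    ∑ (λ (p , z) → ∑ (λ (x , y) → G x y z) (splits (a ∷ p))) (splits w)
      ≈⟨ ∑-congᴬ (splits w) (splits-sound w) (λ (p , z) (_ , p≢[] , _) →
           ∑-splits-∷ a p p≢[] (λ (x , y) → G x y z)) ⟩
    ∑ (λ (p , z) → G [ a ] p z + ∑ (λ (x , y) → G (a ∷ x) y z) (splits p)) (splits w)
      ≈⟨ ∑-+ _ _ (splits w) ⟩
    ∑ (λ (p , z) → G [ a ] p z) (splits w) +
      ∑ (λ (p , z) → ∑ (λ (x , y) → G (a ∷ x) y z) (splits p)) (splits w)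
      ≈⟨ +-congˡ (∑-splits-assoc w (λ x → G (a ∷ x))) ⟩
    ∑ (λ (p , z) → G [ a ] p z) (splits w) +
      ∑ (λ (x , q) → ∑ (λ (y , z) → G (a ∷ x) y z) (splits q)) (splits w)
      ≈⟨ +-congˡ (reflexive (≡.cong sumK (map-∘ (splits w)))) ⟩
    ∑ (λ (x , q) → ∑ (λ (y , z) → G x y z) (splits q)) (splits (a ∷ w)) ∎

  maxL-split : ∀ {w x y} → IsSplit w (x , y) → maxL w ≡ maxL x ⊔ⁿ maxL y
  maxL-split {x = x} {y} (≡.refl , _) = maxL-++ x y

  module _ (t : Test) where

    mulWith-cong : ∀ {f f′ g g′} → f ≐ f′ → g ≐ g′ → mulWith t f g ≐ mulWith t f′ g′
    mulWith-cong f≐f′ g≐g′ w =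
      ∑-cong (splits w) (λ (u , v) → when-cong (t (maxL u) (maxL v)) (*-cong (f≐f′ u) (g≐g′ v)))

    mulWith-⊕ˡ : ∀ f f′ g → mulWith t (f ⊕S f′) g ≐ (mulWith t f g ⊕S mulWith t f′ g)
    mulWith-⊕ˡ f f′ g w = trans
      (∑-cong (splits w) (λ (u , v) → let b = t (maxL u) (maxL v) in
        trans (when-cong b (distribʳ (g v) (f u) (f′ u))) (when-+ b _ _)))
      (∑-+ _ _ (splits w))

    mulWith-⊕ʳ : ∀ f g g′ → mulWith t f (g ⊕S g′) ≐ (mulWith t f g ⊕S mulWith t f g′)
    mulWith-⊕ʳ f g g′ w = trans
      (∑-cong (splits w) (λ (u , v) → let b = t (maxL u) (maxL v) in
        trans (when-cong b (distribˡ (f u) (g v) (g′ v))) (when-+ b _ _)))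
      (∑-+ _ _ (splits w))

    mulWith-⊛ˡ : ∀ a f g → mulWith t (a ⊛S f) g ≐ (a ⊛S mulWith t f g)
    mulWith-⊛ˡ a f g w = trans
      (∑-cong (splits w) (λ (u , v) → let b = t (maxL u) (maxL v) in
        trans (when-cong b (*-assoc a (f u) (g v))) (when-*ˡ b a _)))
      (sym (*-∑ a _ (splits w)))

    mulWith-⊛ʳ : ∀ a f g → mulWith t f (a ⊛S g) ≐ (a ⊛S mulWith t f g)
    mulWith-⊛ʳ a f g w = trans
      (∑-cong (splits w) (λ (u , v) → let b = t (maxL u) (maxL v) in
        trans (when-cong b (x*yz≈y*xz (f u) a (g v))) (when-*ˡ b a _)))
      (sym (*-∑ a _ (splits w)))

  Test₃ : Set
  Test₃ = ℕ → ℕ → ℕ → Bool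

  mul₃ : Test₃ → Ser → Ser → Ser → Ser
  mul₃ H f g h w = ∑ (λ (x , q) → ∑ (λ (y , z) →
    when (H (maxL x) (maxL y) (maxL z)) (f x * (g y * h z))) (splits q)) (splits w)

  mulWith-nestedˡ : ∀ t₁ t₂ f g h →
    mulWith t₁ (mulWith t₂ f g) h ≐ mul₃ (λ a b c → t₁ (a ⊔ⁿ b) c ∧ t₂ a b) f g h
  mulWith-nestedˡ t₁ t₂ f g h w = begin
    mulWith t₁ (mulWith t₂ f g) h w
      ≈⟨ ∑-cong (splits w) (λ (p , z) → expand p z) ⟩
    ∑ (λ (p , z) → ∑ (λ (x , y) → when (H x y z) ((f x * g y) * h z)) (splits p)) (splits w)
      ≈⟨ ∑-splits-assoc w (λ x y z → when (H x y z) ((f x * g y) * h z)) ⟩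
    ∑ (λ (x , q) → ∑ (λ (y , z) → when (H x y z) ((f x * g y) * h z)) (splits q)) (splits w)
      ≈⟨ ∑-cong (splits w) (λ (x , q) → ∑-cong (splits q) (λ (y , z) →
           when-cong (H x y z) (*-assoc (f x) (g y) (h z)))) ⟩
    mul₃ (λ a b c → t₁ (a ⊔ⁿ b) c ∧ t₂ a b) f g h w ∎
    where
    H : Word → Word → Word → Bool
    H x y z = t₁ (maxL x ⊔ⁿ maxL y) (maxL z) ∧ t₂ (maxL x) (maxL y)
    expand : ∀ p z → when (t₁ (maxL p) (maxL z)) (mulWith t₂ f g p * h z) ≈
                     ∑ (λ (x , y) → when (H x y z) ((f x * g y) * h z)) (splits p)
    expand p z = begin
      when b (mulWith t₂ f g p * h z)
        ≈⟨ when-cong b (∑-* (h z) _ (splits p)) ⟩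
      when b (∑ (λ (x , y) → when (t₂ (maxL x) (maxL y)) (f x * g y) * h z) (splits p))
        ≈⟨ when-∑ b _ (splits p) ⟩
      ∑ (λ (x , y) → when b (when (t₂ (maxL x) (maxL y)) (f x * g y) * h z)) (splits p)
        ≈⟨ ∑-congᴬ (splits p) (splits-sound p) (λ (x , y) split → let d = t₂ (maxL x) (maxL y) in
             trans (when-cong b (sym (when-*ʳ d _ _))) (trans (when-when b d _)
               (reflexive (≡.cong (λ m → when (t₁ m (maxL z) ∧ d) ((f x * g y) * h z))
                                  (maxL-split split))))) ⟩
      ∑ (λ (x , y) → when (H x y z) ((f x * g y) * h z)) (splits p) ∎
      where b = t₁ (maxL p) (maxL z)

  mulWith-nestedʳ : ∀ t₁ t₂ f g h →
    mulWith t₁ f (mulWith t₂ g h) ≐ mul₃ (λ a b c → t₁ a (b ⊔ⁿ c) ∧ t₂ b c) f g h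
  mulWith-nestedʳ t₁ t₂ f g h w = ∑-cong (splits w) (λ (x , q) → expand x q)
    where
    expand : ∀ x q → when (t₁ (maxL x) (maxL q)) (f x * mulWith t₂ g h q) ≈
      ∑ (λ (y , z) → when (t₁ (maxL x) (maxL y ⊔ⁿ maxL z) ∧ t₂ (maxL y) (maxL z))
                          (f x * (g y * h z))) (splits q)
    expand x q = begin
      when b (f x * mulWith t₂ g h q)
        ≈⟨ when-cong b (*-∑ (f x) _ (splits q)) ⟩
      when b (∑ (λ (y , z) → f x * when (t₂ (maxL y) (maxL z)) (g y * h z)) (splits q))
        ≈⟨ when-∑ b _ (splits q) ⟩
      ∑ (λ (y , z) → when b (f x * when (t₂ (maxL y) (maxL z)) (g y * h z))) (splits q)
        ≈⟨ ∑-congᴬ (splits q) (splits-sound q) (λ (y , z) split → let d = t₂ (maxL y) (maxL z) in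
             trans (when-cong b (sym (when-*ˡ d _ _))) (trans (when-when b d _)
               (reflexive (≡.cong (λ m → when (t₁ (maxL x) m ∧ d) (f x * (g y * h z)))
                                  (maxL-split split))))) ⟩
      ∑ (λ (y , z) → when (t₁ (maxL x) (maxL y ⊔ⁿ maxL z) ∧ t₂ (maxL y) (maxL z))
                          (f x * (g y * h z))) (splits q) ∎
      where b = t₁ (maxL x) (maxL q)

  mul₃-cong : ∀ {H H′} → (∀ a b c → H a b c ≡ H′ a b c) →
              ∀ f g h → mul₃ H f g h ≐ mul₃ H′ f g h
  mul₃-cong H≡H′ f g h w = ∑-cong (splits w) (λ (x , q) → ∑-cong (splits q) (λ (y , z) →
    reflexive (≡.cong (λ b → when b (f x * (g y * h z))) (H≡H′ (maxL x) (maxL y) (maxL z)))))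

  when-exactlyOne : ∀ b {p q r} → ExactlyOne p q r → ∀ x →
                    (when (b ∧ p) x + when (b ∧ q) x) + when (b ∧ r) x ≈ when b x
  when-exactlyOne false _      x = trans (+-identityʳ _) (+-identityʳ _)
  when-exactlyOne true  first  x = trans (+-identityʳ _) (+-identityʳ _)
  when-exactlyOne true  second x = trans (+-identityʳ _) (+-identityˡ _)
  when-exactlyOne true  third  x = trans (+-congʳ (+-identityʳ _)) (+-identityˡ _)

  refine : Test₃ → Test → (i j : ℕ → ℕ → ℕ → ℕ) → Test₃
  refine H t i j a b c = H a b c ∧ t (i a b c) (j a b c)

  mul₃-refine : ∀ H i j f g h w →
    (mul₃ (refine H test≺ i j) f g h w + mul₃ (refine H test∘ i j) f g h w)
      + mul₃ (refine H test≻ i j) f g h w ≈ mul₃ H f g h w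
  mul₃-refine H i j f g h w = begin
    (∑ (inner test≺) (splits w) + ∑ (inner test∘) (splits w)) + ∑ (inner test≻) (splits w)
      ≈⟨ +-congʳ (sym (∑-+ _ _ (splits w))) ⟩
    ∑ (λ p → inner test≺ p + inner test∘ p) (splits w) + ∑ (inner test≻) (splits w)
      ≈⟨ sym (∑-+ _ _ (splits w)) ⟩
    ∑ (λ p → (inner test≺ p + inner test∘ p) + inner test≻ p) (splits w)
      ≈⟨ ∑-cong (splits w) (λ (x , q) → trans (+-congʳ (sym (∑-+ _ _ (splits q))))
           (trans (sym (∑-+ _ _ (splits q))) (∑-cong (splits q) (λ (y , z) →
             let a = maxL x ; b = maxL y ; c = maxL z in
             when-exactlyOne (H a b c) (tests-exactlyOne (i a b c) (j a b c)) _)))) ⟩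
    mul₃ H f g h w ∎
    where
    inner : Test → Word × Word → Carrier
    inner t (x , q) = ∑ (λ (y , z) →
      when (refine H t i j (maxL x) (maxL y) (maxL z)) (f x * (g y * h z))) (splits q)

  mulWith-assoc : ∀ t₁ t₂ t₁′ t₂′ →
    (∀ a b c → (t₁ (a ⊔ⁿ b) c ∧ t₂ a b) ≡ (t₁′ a (b ⊔ⁿ c) ∧ t₂′ b c)) →
    ∀ f g h → mulWith t₁ (mulWith t₂ f g) h ≐ mulWith t₁′ f (mulWith t₂′ g h)
  mulWith-assoc t₁ t₂ t₁′ t₂′ tests≡ f g h w = begin
    mulWith t₁ (mulWith t₂ f g) h w                    ≈⟨ mulWith-nestedˡ t₁ t₂ f g h w ⟩
    mul₃ (λ a b c → t₁ (a ⊔ⁿ b) c ∧ t₂ a b) f g h w    ≈⟨ mul₃-cong tests≡ f g h w ⟩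
    mul₃ (λ a b c → t₁′ a (b ⊔ⁿ c) ∧ t₂′ b c) f g h w  ≈⟨ mulWith-nestedʳ t₁′ t₂′ f g h w ⟨
    mulWith t₁′ f (mulWith t₂′ g h) w                  ∎

  _·S_ : Ser → Ser → Ser
  f ·S g = ((f ≺S g) ⊕S (f ⊚S g)) ⊕S (f ≻S g)

  ≺≺-assoc : ∀ f g h → ((f ≺S g) ≺S h) ≐ (f ≺S (g ·S h))
  ≺≺-assoc f g h w = begin
    ((f ≺S g) ≺S h) w
      ≈⟨ mulWith-nestedˡ test≺ test≺ f g h w ⟩
    mul₃ (λ a b c → test≺ (a ⊔ⁿ b) c ∧ test≺ a b) f g h w
      ≈⟨ mul₃-cong ≺≺-tests f g h w ⟩
    mul₃ (λ a b c → test≺ a (b ⊔ⁿ c)) f g h w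
      ≈⟨ mul₃-refine (λ a b c → test≺ a (b ⊔ⁿ c)) (λ _ b _ → b) (λ _ _ c → c) f g h w ⟨
    (mul₃ (λ a b c → test≺ a (b ⊔ⁿ c) ∧ test≺ b c) f g h w
      + mul₃ (λ a b c → test≺ a (b ⊔ⁿ c) ∧ test∘ b c) f g h w)
      + mul₃ (λ a b c → test≺ a (b ⊔ⁿ c) ∧ test≻ b c) f g h w
      ≈⟨ +-cong (+-cong (mulWith-nestedʳ test≺ test≺ f g h w) (mulWith-nestedʳ test≺ test∘ f g h w))
                (mulWith-nestedʳ test≺ test≻ f g h w) ⟨
    ((f ≺S (g ≺S h)) w + (f ≺S (g ⊚S h)) w) + (f ≺S (g ≻S h)) w
      ≈⟨ trans (mulWith-⊕ʳ test≺ f _ _ w) (+-congʳ (mulWith-⊕ʳ test≺ f _ _ w)) ⟨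
    (f ≺S (g ·S h)) w ∎

  ≻≻-assoc : ∀ f g h → ((f ·S g) ≻S h) ≐ (f ≻S (g ≻S h))
  ≻≻-assoc f g h w = begin
    ((f ·S g) ≻S h) w
      ≈⟨ trans (mulWith-⊕ˡ test≻ _ _ h w) (+-congʳ (mulWith-⊕ˡ test≻ _ _ h w)) ⟩
    (((f ≺S g) ≻S h) w + ((f ⊚S g) ≻S h) w) + ((f ≻S g) ≻S h) w
      ≈⟨ +-cong (+-cong (mulWith-nestedˡ test≻ test≺ f g h w) (mulWith-nestedˡ test≻ test∘ f g h w))
                (mulWith-nestedˡ test≻ test≻ f g h w) ⟩
    (mul₃ (λ a b c → test≻ (a ⊔ⁿ b) c ∧ test≺ a b) f g h w
      + mul₃ (λ a b c → test≻ (a ⊔ⁿ b) c ∧ test∘ a b) f g h w)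
      + mul₃ (λ a b c → test≻ (a ⊔ⁿ b) c ∧ test≻ a b) f g h w
      ≈⟨ mul₃-refine (λ a b c → test≻ (a ⊔ⁿ b) c) (λ a _ _ → a) (λ _ b _ → b) f g h w ⟩
    mul₃ (λ a b c → test≻ (a ⊔ⁿ b) c) f g h w
      ≈⟨ mul₃-cong ≻≻-tests f g h w ⟩
    mul₃ (λ a b c → test≻ a (b ⊔ⁿ c) ∧ test≻ b c) f g h w
      ≈⟨ mulWith-nestedʳ test≻ test≻ f g h w ⟨
    (f ≻S (g ≻S h)) w ∎

  φ-cong : ∀ s t → s ~ t → φ s ≐ φ t
  φ-cong s .s ~refl              w = refl
  φ-cong s t  (~sym t~s)         w = sym (φ-cong t s t~s w)
  φ-cong s t  (~trans s~u u~t)   w = trans (φ-cong _ _ s~u w) (φ-cong _ _ u~t w)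
  φ-cong _ _  (⊕-cong s~s′ t~t′) w = +-cong (φ-cong _ _ s~s′ w) (φ-cong _ _ t~t′ w)
  φ-cong _ _  (⊛-cong a≈b s~t)   w = *-cong a≈b (φ-cong _ _ s~t w)
  φ-cong _ _  (≺-cong s~s′ t~t′) w = mulWith-cong test≺ (φ-cong _ _ s~s′) (φ-cong _ _ t~t′) w
  φ-cong _ _  (⊚-cong s~s′ t~t′) w = mulWith-cong test∘ (φ-cong _ _ s~s′) (φ-cong _ _ t~t′) w
  φ-cong _ _  (≻-cong s~s′ t~t′) w = mulWith-cong test≻ (φ-cong _ _ s~s′) (φ-cong _ _ t~t′) w
  φ-cong _ _  (⊕-assoc s t u)    w = +-assoc _ _ _
  φ-cong _ _  (⊕-comm s t)       w = +-comm _ _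
  φ-cong _ _  (⊕-idˡ s)          w = +-identityˡ _
  φ-cong _ _  (⊕-inv s)          w = trans (+-congʳ (-1*x≈-x _)) (-‿inverseˡ _)
  φ-cong _ _  (⊛-one s)          w = *-identityˡ _
  φ-cong _ _  (⊛-assoc a b s)    w = *-assoc _ _ _
  φ-cong _ _  (⊛-distʳ a s t)    w = distribˡ _ _ _
  φ-cong _ _  (⊛-distˡ a b s)    w = distribʳ _ _ _
  φ-cong _ _  (≺-⊕ˡ s t u)       w = mulWith-⊕ˡ test≺ _ _ _ w
  φ-cong _ _  (≺-⊕ʳ s t u)       w = mulWith-⊕ʳ test≺ _ _ _ w
  φ-cong _ _  (≺-⊛ˡ a s t)       w = mulWith-⊛ˡ test≺ a _ _ w
  φ-cong _ _  (≺-⊛ʳ a s t)       w = mulWith-⊛ʳ test≺ a _ _ w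
  φ-cong _ _  (⊚-⊕ˡ s t u)       w = mulWith-⊕ˡ test∘ _ _ _ w
  φ-cong _ _  (⊚-⊕ʳ s t u)       w = mulWith-⊕ʳ test∘ _ _ _ w
  φ-cong _ _  (⊚-⊛ˡ a s t)       w = mulWith-⊛ˡ test∘ a _ _ w
  φ-cong _ _  (⊚-⊛ʳ a s t)       w = mulWith-⊛ʳ test∘ a _ _ w
  φ-cong _ _  (≻-⊕ˡ s t u)       w = mulWith-⊕ˡ test≻ _ _ _ w
  φ-cong _ _  (≻-⊕ʳ s t u)       w = mulWith-⊕ʳ test≻ _ _ _ w
  φ-cong _ _  (≻-⊛ˡ a s t)       w = mulWith-⊛ˡ test≻ a _ _ w
  φ-cong _ _  (≻-⊛ʳ a s t)       w = mulWith-⊛ʳ test≻ a _ _ w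
  φ-cong _ _  (⊚-assoc x y z)    w = mulWith-assoc test∘ test∘ test∘ test∘ ∘∘-tests (φ x) (φ y) (φ z) w
  φ-cong _ _  (ax1 x y z)        w = ≺≺-assoc (φ x) (φ y) (φ z) w
  φ-cong _ _  (ax2 x y z)        w = mulWith-assoc test≺ test≻ test≻ test≺ ≻≺-tests (φ x) (φ y) (φ z) w
  φ-cong _ _  (ax3 x y z)        w = ≻≻-assoc (φ x) (φ y) (φ z) w
  φ-cong _ _  (ax4 x y z)        w = mulWith-assoc test∘ test≻ test≻ test∘ ≻∘-tests (φ x) (φ y) (φ z) w
  φ-cong _ _  (ax5 x y z)        w = mulWith-assoc test∘ test≺ test∘ test≻ ≺∘-tests (φ x) (φ y) (φ z) w
  φ-cong _ _  (ax6 x y z)        w = mulWith-assoc test≺ test∘ test∘ test≺ ∘≺-tests (φ x) (φ y) (φ z) w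

-- A tree denotes T₀ ≻ (Z₁ ∘ ⋯ ∘ Zₖ), the factor T₀ ≻ being optional; an atom is x or x ≺ T.
mutual
  data Tree : Set where
    tree : Maybe Tree → Chain → Tree

  data Chain : Set where
    single : Atom → Chain
    _∘∷_   : Atom → Chain → Chain

  data Atom : Set where
    leaf   : Atom
    leaf≺_ : Tree → Atom

infixr 5 _∘∷_
infixl 6 _≺ᵗ_ _∘ᵗ_ _≻ᵗ_ _·ᵗ_ _≺ᶜ_ _∘ᶜ_ _≺ᵃ_ _∘ᵃ_

mutual
  _≺ᵗ_ : Tree → Tree → List Tree
  tree o P ≺ᵗ B = map (tree o) (P ≺ᶜ B)

  _≺ᶜ_ : Chain → Tree → List Chain
  single Z ≺ᶜ B = map single (Z ≺ᵃ B)
  (Z ∘∷ P) ≺ᶜ B = map (Z ∘∷_) (P ≺ᶜ B)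

  _≺ᵃ_ : Atom → Tree → List Atom
  leaf      ≺ᵃ B = [ leaf≺ B ]
  (leaf≺ A) ≺ᵃ B = map leaf≺_ (A ·ᵗ B)

  _∘ᵗ_ : Tree → Tree → List Tree
  tree o P ∘ᵗ B = map (tree o) (P ∘ᶜ B)

  _∘ᶜ_ : Chain → Tree → List Chain
  (Z ∘∷ P) ∘ᶜ B         = map (Z ∘∷_) (P ∘ᶜ B)
  single Z ∘ᶜ tree o P′ = map (_∘∷ P′) (Z ∘ᵃ o)

  _∘ᵃ_ : Atom → Maybe Tree → List Atom
  Z         ∘ᵃ nothing = [ Z ]
  leaf      ∘ᵃ just B  = [ leaf≺ B ]
  (leaf≺ A) ∘ᵃ just B  = map leaf≺_ (A ·ᵗ B)

  _≻ᵗ_ : Tree → Tree → List Tree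
  A ≻ᵗ tree nothing  P = [ tree (just A) P ]
  A ≻ᵗ tree (just B) P = map (λ X → tree (just X) P) (A ·ᵗ B)

  _·ᵗ_ : Tree → Tree → List Tree
  A ·ᵗ B = (A ≺ᵗ B ++ A ∘ᵗ B) ++ A ≻ᵗ B

module NormalForm {c ℓ} (F : Field c ℓ) where
  open Field F using (Carrier; _*_; 0#; 1#; refl; +-identityˡ; *-comm)
  open Construction F

  ~-setoid : Setoid c (c ⊔ ℓ)
  ~-setoid = record
    { Carrier = Tm ; _≈_ = _~_ ; isEquivalence = record { refl = ~refl ; sym = ~sym ; trans = ~trans } }

  open SetoidReasoning ~-setoid

  ≡⇒~ : ∀ {s t} → s ≡ t → s ~ t
  ≡⇒~ ≡.refl = ~refl

  mutual
    ⟦_⟧ᵗ : Tree → Tm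
    ⟦ tree nothing  P ⟧ᵗ = ⟦ P ⟧ᶜ
    ⟦ tree (just A) P ⟧ᵗ = ⟦ A ⟧ᵗ ≻ ⟦ P ⟧ᶜ

    ⟦_⟧ᶜ : Chain → Tm
    ⟦ single Z ⟧ᶜ = ⟦ Z ⟧ᵃ
    ⟦ Z ∘∷ P   ⟧ᶜ = ⟦ Z ⟧ᵃ ⊚ ⟦ P ⟧ᶜ

    ⟦_⟧ᵃ : Atom → Tm
    ⟦ leaf    ⟧ᵃ = gen
    ⟦ leaf≺ A ⟧ᵃ = gen ≺ ⟦ A ⟧ᵗ

  sumTm : ∀ {a} {X : Set a} → (X → Tm) → List X → Tm
  sumTm e = foldr (λ x acc → e x ⊕ acc) nil

  sumTm-++ : ∀ {a} {X : Set a} (e : X → Tm) xs ys → sumTm e (xs ++ ys) ~ sumTm e xs ⊕ sumTm e ys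
  sumTm-++ e []       ys = ~sym (⊕-idˡ _)
  sumTm-++ e (x ∷ xs) ys = ~trans (⊕-cong ~refl (sumTm-++ e xs ys)) (~sym (⊕-assoc _ _ _))

  ⊕-idʳ : ∀ s → s ⊕ nil ~ s
  ⊕-idʳ s = ~trans (⊕-comm s nil) (⊕-idˡ s)

  ⊛-zero : ∀ s → 0# ⊛ s ~ nil
  ⊛-zero s = ~sym (begin
    nil                     ≈⟨ ⊕-inv 0s ⟨
    (- 1#) ⊛ 0s ⊕ 0s        ≈⟨ ⊕-cong ~refl 0s⊕0s~0s ⟨
    (- 1#) ⊛ 0s ⊕ (0s ⊕ 0s) ≈⟨ ⊕-assoc _ _ _ ⟨
    ((- 1#) ⊛ 0s ⊕ 0s) ⊕ 0s ≈⟨ ⊕-cong (⊕-inv 0s) ~refl ⟩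
    nil ⊕ 0s                ≈⟨ ⊕-idˡ 0s ⟩
    0s                      ∎)
    where
    open Field F using (-_)
    0s = 0# ⊛ s
    0s⊕0s~0s : 0s ⊕ 0s ~ 0s
    0s⊕0s~0s = ~trans (~sym (⊛-distˡ 0# 0# s)) (⊛-cong (+-identityˡ 0#) ~refl)

  record Linear (G : Tm → Tm) : Set (c ⊔ ℓ) where
    field
      congruent   : ∀ {s t} → s ~ t → G s ~ G t
      additive    : ∀ s t → G (s ⊕ t) ~ G s ⊕ G t
      homogeneous : ∀ a s → G (a ⊛ s) ~ a ⊛ G s

    preserves-nil : G nil ~ nil
    preserves-nil = begin
      G nil        ≈⟨ congruent (~sym (⊛-zero nil)) ⟩
      G (0# ⊛ nil) ≈⟨ homogeneous 0# nil ⟩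
      0# ⊛ G nil   ≈⟨ ⊛-zero _ ⟩
      nil          ∎

    sumTm-map : ∀ {a b} {X : Set a} {Y : Set b} {eX : X → Tm} {eY : Y → Tm} (g : X → Y) →
                (∀ x → eY (g x) ~ G (eX x)) → ∀ xs → sumTm eY (map g xs) ~ G (sumTm eX xs)
    sumTm-map g eYg~GeX []       = ~sym preserves-nil
    sumTm-map g eYg~GeX (x ∷ xs) =
      ~trans (⊕-cong (eYg~GeX x) (sumTm-map g eYg~GeX xs)) (~sym (additive _ _))

  open Linear

  id-linear : Linear (λ s → s)
  id-linear = record { congruent = λ s~t → s~t ; additive = λ _ _ → ~refl ; homogeneous = λ _ _ → ~refl }

  ⊛-linear : ∀ a → Linear (a ⊛_)
  ⊛-linear a = record
    { congruent   = ⊛-cong refl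
    ; additive    = ⊛-distʳ a
    ; homogeneous = λ b s →
        ~trans (~sym (⊛-assoc a b s)) (~trans (⊛-cong (*-comm a b) ~refl) (⊛-assoc b a s))
    }

  ≺-linearˡ : ∀ t → Linear (_≺ t)
  ≺-linearˡ t = record
    { congruent   = λ e → ≺-cong e ~refl
    ; additive    = λ s u → ≺-⊕ˡ s u t
    ; homogeneous = λ a s → ≺-⊛ˡ a s t
    }

  ≺-linearʳ : ∀ t → Linear (t ≺_)
  ≺-linearʳ t = record
    { congruent   = ≺-cong ~refl
    ; additive    = ≺-⊕ʳ t
    ; homogeneous = λ a s → ≺-⊛ʳ a t s
    }

  ⊚-linearˡ : ∀ t → Linear (_⊚ t)
  ⊚-linearˡ t = record
    { congruent   = λ e → ⊚-cong e ~refl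
    ; additive    = λ s u → ⊚-⊕ˡ s u t
    ; homogeneous = λ a s → ⊚-⊛ˡ a s t
    }

  ⊚-linearʳ : ∀ t → Linear (t ⊚_)
  ⊚-linearʳ t = record
    { congruent   = ⊚-cong ~refl
    ; additive    = ⊚-⊕ʳ t
    ; homogeneous = λ a s → ⊚-⊛ʳ a t s
    }

  ≻-linearˡ : ∀ t → Linear (_≻ t)
  ≻-linearˡ t = record
    { congruent   = λ e → ≻-cong e ~refl
    ; additive    = λ s u → ≻-⊕ˡ s u t
    ; homogeneous = λ a s → ≻-⊛ˡ a s t
    }

  ≻-linearʳ : ∀ t → Linear (t ≻_)
  ≻-linearʳ t = record
    { congruent   = ≻-cong ~refl
    ; additive    = ≻-⊕ʳ t
    ; homogeneous = λ a s → ≻-⊛ʳ a t s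
    }

  ⟦_⟧ᵗˢ : List Tree → Tm
  ⟦_⟧ᵗˢ = sumTm ⟦_⟧ᵗ

  s~s⊕nil : ∀ s → s ~ s ⊕ nil
  s~s⊕nil s = ~sym (⊕-idʳ s)

  mutual
    ≺ᵗ-sound : ∀ A B → ⟦ A ⟧ᵗ ≺ ⟦ B ⟧ᵗ ~ ⟦ A ≺ᵗ B ⟧ᵗˢ
    ≺ᵗ-sound (tree nothing P) B =
      ~trans (≺ᶜ-sound P B) (~sym (sumTm-map id-linear (tree nothing) (λ _ → ~refl) (P ≺ᶜ B)))
    ≺ᵗ-sound (tree (just A) P) B = begin
      (⟦ A ⟧ᵗ ≻ ⟦ P ⟧ᶜ) ≺ ⟦ B ⟧ᵗ
        ≈⟨ ax2 _ _ _ ⟩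
      ⟦ A ⟧ᵗ ≻ (⟦ P ⟧ᶜ ≺ ⟦ B ⟧ᵗ)
        ≈⟨ ≻-cong ~refl (≺ᶜ-sound P B) ⟩
      ⟦ A ⟧ᵗ ≻ sumTm ⟦_⟧ᶜ (P ≺ᶜ B)
        ≈⟨ sumTm-map (≻-linearʳ _) (tree (just A)) (λ _ → ~refl) (P ≺ᶜ B) ⟨
      ⟦ tree (just A) P ≺ᵗ B ⟧ᵗˢ ∎

    ≺ᶜ-sound : ∀ P B → ⟦ P ⟧ᶜ ≺ ⟦ B ⟧ᵗ ~ sumTm ⟦_⟧ᶜ (P ≺ᶜ B)
    ≺ᶜ-sound (single Z) B =
      ~trans (≺ᵃ-sound Z B) (~sym (sumTm-map id-linear single (λ _ → ~refl) (Z ≺ᵃ B)))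
    ≺ᶜ-sound (Z ∘∷ P) B = begin
      (⟦ Z ⟧ᵃ ⊚ ⟦ P ⟧ᶜ) ≺ ⟦ B ⟧ᵗ
        ≈⟨ ax6 _ _ _ ⟩
      ⟦ Z ⟧ᵃ ⊚ (⟦ P ⟧ᶜ ≺ ⟦ B ⟧ᵗ)
        ≈⟨ ⊚-cong ~refl (≺ᶜ-sound P B) ⟩
      ⟦ Z ⟧ᵃ ⊚ sumTm ⟦_⟧ᶜ (P ≺ᶜ B)
        ≈⟨ sumTm-map (⊚-linearʳ _) (Z ∘∷_) (λ _ → ~refl) (P ≺ᶜ B) ⟨
      sumTm ⟦_⟧ᶜ ((Z ∘∷ P) ≺ᶜ B) ∎

    ≺ᵃ-sound : ∀ Z B → ⟦ Z ⟧ᵃ ≺ ⟦ B ⟧ᵗ ~ sumTm ⟦_⟧ᵃ (Z ≺ᵃ B)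
    ≺ᵃ-sound leaf      B = s~s⊕nil _
    ≺ᵃ-sound (leaf≺ A) B = begin
      (gen ≺ ⟦ A ⟧ᵗ) ≺ ⟦ B ⟧ᵗ
        ≈⟨ ax1 _ _ _ ⟩
      gen ≺ (⟦ A ⟧ᵗ · ⟦ B ⟧ᵗ)
        ≈⟨ ≺-cong ~refl (·ᵗ-sound A B) ⟩
      gen ≺ ⟦ A ·ᵗ B ⟧ᵗˢ
        ≈⟨ sumTm-map (≺-linearʳ _) leaf≺_ (λ _ → ~refl) (A ·ᵗ B) ⟨
      sumTm ⟦_⟧ᵃ (leaf≺ A ≺ᵃ B) ∎

    ∘ᵗ-sound : ∀ A B → ⟦ A ⟧ᵗ ⊚ ⟦ B ⟧ᵗ ~ ⟦ A ∘ᵗ B ⟧ᵗˢ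
    ∘ᵗ-sound (tree nothing P) B =
      ~trans (∘ᶜ-sound P B) (~sym (sumTm-map id-linear (tree nothing) (λ _ → ~refl) (P ∘ᶜ B)))
    ∘ᵗ-sound (tree (just A) P) B = begin
      (⟦ A ⟧ᵗ ≻ ⟦ P ⟧ᶜ) ⊚ ⟦ B ⟧ᵗ
        ≈⟨ ax4 _ _ _ ⟩
      ⟦ A ⟧ᵗ ≻ (⟦ P ⟧ᶜ ⊚ ⟦ B ⟧ᵗ)
        ≈⟨ ≻-cong ~refl (∘ᶜ-sound P B) ⟩
      ⟦ A ⟧ᵗ ≻ sumTm ⟦_⟧ᶜ (P ∘ᶜ B)
        ≈⟨ sumTm-map (≻-linearʳ _) (tree (just A)) (λ _ → ~refl) (P ∘ᶜ B) ⟨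
      ⟦ tree (just A) P ∘ᵗ B ⟧ᵗˢ ∎

    ∘ᶜ-sound : ∀ P B → ⟦ P ⟧ᶜ ⊚ ⟦ B ⟧ᵗ ~ sumTm ⟦_⟧ᶜ (P ∘ᶜ B)
    ∘ᶜ-sound (Z ∘∷ P) B = begin
      (⟦ Z ⟧ᵃ ⊚ ⟦ P ⟧ᶜ) ⊚ ⟦ B ⟧ᵗ
        ≈⟨ ⊚-assoc _ _ _ ⟩
      ⟦ Z ⟧ᵃ ⊚ (⟦ P ⟧ᶜ ⊚ ⟦ B ⟧ᵗ)
        ≈⟨ ⊚-cong ~refl (∘ᶜ-sound P B) ⟩
      ⟦ Z ⟧ᵃ ⊚ sumTm ⟦_⟧ᶜ (P ∘ᶜ B)
        ≈⟨ sumTm-map (⊚-linearʳ _) (Z ∘∷_) (λ _ → ~refl) (P ∘ᶜ B) ⟨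
      sumTm ⟦_⟧ᶜ ((Z ∘∷ P) ∘ᶜ B) ∎
    ∘ᶜ-sound (single Z) (tree o P′) = begin
      ⟦ Z ⟧ᵃ ⊚ ⟦ tree o P′ ⟧ᵗ
        ≈⟨ ∘ᵃ-sound Z o P′ ⟩
      sumTm ⟦_⟧ᵃ (Z ∘ᵃ o) ⊚ ⟦ P′ ⟧ᶜ
        ≈⟨ sumTm-map (⊚-linearˡ _) (_∘∷ P′) (λ _ → ~refl) (Z ∘ᵃ o) ⟨
      sumTm ⟦_⟧ᶜ (single Z ∘ᶜ tree o P′) ∎

    ∘ᵃ-sound : ∀ Z o P′ →
               ⟦ Z ⟧ᵃ ⊚ ⟦ tree o P′ ⟧ᵗ ~ sumTm ⟦_⟧ᵃ (Z ∘ᵃ o) ⊚ ⟦ P′ ⟧ᶜ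
    ∘ᵃ-sound Z         nothing  P′ = ⊚-cong (s~s⊕nil _) ~refl
    ∘ᵃ-sound leaf      (just B) P′ = ~trans (~sym (ax5 _ _ _)) (⊚-cong (s~s⊕nil _) ~refl)
    ∘ᵃ-sound (leaf≺ A) (just B) P′ = ~trans (~sym (ax5 _ _ _)) (⊚-cong (≺ᵃ-sound (leaf≺ A) B) ~refl)

    ≻ᵗ-sound : ∀ A B → ⟦ A ⟧ᵗ ≻ ⟦ B ⟧ᵗ ~ ⟦ A ≻ᵗ B ⟧ᵗˢ
    ≻ᵗ-sound A (tree nothing  P) = s~s⊕nil _
    ≻ᵗ-sound A (tree (just B) P) = begin
      ⟦ A ⟧ᵗ ≻ (⟦ B ⟧ᵗ ≻ ⟦ P ⟧ᶜ)
        ≈⟨ ax3 _ _ _ ⟨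
      (⟦ A ⟧ᵗ · ⟦ B ⟧ᵗ) ≻ ⟦ P ⟧ᶜ
        ≈⟨ ≻-cong (·ᵗ-sound A B) ~refl ⟩
      ⟦ A ·ᵗ B ⟧ᵗˢ ≻ ⟦ P ⟧ᶜ
        ≈⟨ sumTm-map (≻-linearˡ _) (λ X → tree (just X) P) (λ _ → ~refl) (A ·ᵗ B) ⟨
      ⟦ A ≻ᵗ tree (just B) P ⟧ᵗˢ ∎

    ·ᵗ-sound : ∀ A B → ⟦ A ⟧ᵗ · ⟦ B ⟧ᵗ ~ ⟦ A ·ᵗ B ⟧ᵗˢ
    ·ᵗ-sound A B = begin
      ⟦ A ⟧ᵗ ≺ ⟦ B ⟧ᵗ ⊕ ⟦ A ⟧ᵗ ⊚ ⟦ B ⟧ᵗ ⊕ ⟦ A ⟧ᵗ ≻ ⟦ B ⟧ᵗ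
        ≈⟨ ⊕-cong (⊕-cong (≺ᵗ-sound A B) (∘ᵗ-sound A B)) (≻ᵗ-sound A B) ⟩
      ⟦ A ≺ᵗ B ⟧ᵗˢ ⊕ ⟦ A ∘ᵗ B ⟧ᵗˢ ⊕ ⟦ A ≻ᵗ B ⟧ᵗˢ
        ≈⟨ ⊕-cong (sumTm-++ ⟦_⟧ᵗ (A ≺ᵗ B) (A ∘ᵗ B)) ~refl ⟨
      ⟦ A ≺ᵗ B ++ A ∘ᵗ B ⟧ᵗˢ ⊕ ⟦ A ≻ᵗ B ⟧ᵗˢ
        ≈⟨ sumTm-++ ⟦_⟧ᵗ (A ≺ᵗ B ++ A ∘ᵗ B) (A ≻ᵗ B) ⟨
      ⟦ A ·ᵗ B ⟧ᵗˢ ∎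

  LinComb : Set c
  LinComb = List (Carrier × Tree)

  ⟦_⟧ˡ : LinComb → Tm
  ⟦_⟧ˡ = sumTm (λ (a , A) → a ⊛ ⟦ A ⟧ᵗ)

  ⟦⟧ˡ-++ : ∀ L M → ⟦ L ++ M ⟧ˡ ~ ⟦ L ⟧ˡ ⊕ ⟦ M ⟧ˡ
  ⟦⟧ˡ-++ = sumTm-++ (λ (a , A) → a ⊛ ⟦ A ⟧ᵗ)

  scale : Carrier → LinComb → LinComb
  scale a = map (λ (b , A) → (a * b , A))

  ⟦⟧ˡ-scale : ∀ a L → ⟦ scale a L ⟧ˡ ~ a ⊛ ⟦ L ⟧ˡ
  ⟦⟧ˡ-scale a = sumTm-map (⊛-linear a) _ (λ (b , A) → ⊛-assoc a b ⟦ A ⟧ᵗ)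

  with-coefficient : Carrier → List Tree → LinComb
  with-coefficient a = map (λ A → (a , A))

  ⟦with-coefficient⟧ : ∀ a As → ⟦ with-coefficient a As ⟧ˡ ~ a ⊛ ⟦ As ⟧ᵗˢ
  ⟦with-coefficient⟧ a = sumTm-map (⊛-linear a) _ (λ _ → ~refl)

  product : (Tree → Tree → List Tree) → LinComb → LinComb → LinComb
  product _⋆ᵗ_ L M =
    concatMap (λ (a , A) → concatMap (λ (b , B) → with-coefficient (a * b) (A ⋆ᵗ B)) M) L

  module _ (_⋆_ : Tm → Tm → Tm) (_⋆ᵗ_ : Tree → Tree → List Tree)
           (⋆-linearˡ : ∀ t → Linear (_⋆ t)) (⋆-linearʳ : ∀ t → Linear (t ⋆_))
           (⋆ᵗ-sound : ∀ A B → ⟦ A ⟧ᵗ ⋆ ⟦ B ⟧ᵗ ~ ⟦ A ⋆ᵗ B ⟧ᵗˢ) where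

    product-sound : ∀ L M → ⟦ L ⟧ˡ ⋆ ⟦ M ⟧ˡ ~ ⟦ product _⋆ᵗ_ L M ⟧ˡ
    product-sound []            M = preserves-nil (⋆-linearˡ _)
    product-sound ((a , A) ∷ L) M = begin
      (a ⊛ ⟦ A ⟧ᵗ ⊕ ⟦ L ⟧ˡ) ⋆ ⟦ M ⟧ˡ          ≈⟨ additive (⋆-linearˡ _) _ _ ⟩
      (a ⊛ ⟦ A ⟧ᵗ) ⋆ ⟦ M ⟧ˡ ⊕ ⟦ L ⟧ˡ ⋆ ⟦ M ⟧ˡ ≈⟨ ⊕-cong (row M) (product-sound L M) ⟩
      ⟦ rowᵗ M ⟧ˡ ⊕ ⟦ product _⋆ᵗ_ L M ⟧ˡ     ≈⟨ ⟦⟧ˡ-++ (rowᵗ M) _ ⟨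
      ⟦ product _⋆ᵗ_ ((a , A) ∷ L) M ⟧ˡ       ∎
      where
      rowᵗ : LinComb → LinComb
      rowᵗ = concatMap (λ (b , B) → with-coefficient (a * b) (A ⋆ᵗ B))
      term : ∀ b B → (a ⊛ ⟦ A ⟧ᵗ) ⋆ (b ⊛ ⟦ B ⟧ᵗ) ~ ⟦ with-coefficient (a * b) (A ⋆ᵗ B) ⟧ˡ
      term b B = begin
        (a ⊛ ⟦ A ⟧ᵗ) ⋆ (b ⊛ ⟦ B ⟧ᵗ) ≈⟨ homogeneous (⋆-linearˡ _) a _ ⟩
        a ⊛ (⟦ A ⟧ᵗ ⋆ (b ⊛ ⟦ B ⟧ᵗ)) ≈⟨ ⊛-cong refl (homogeneous (⋆-linearʳ _) b _) ⟩
        a ⊛ (b ⊛ (⟦ A ⟧ᵗ ⋆ ⟦ B ⟧ᵗ)) ≈⟨ ⊛-assoc a b _ ⟨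
        (a * b) ⊛ (⟦ A ⟧ᵗ ⋆ ⟦ B ⟧ᵗ) ≈⟨ ⊛-cong refl (⋆ᵗ-sound A B) ⟩
        (a * b) ⊛ ⟦ A ⋆ᵗ B ⟧ᵗˢ       ≈⟨ ⟦with-coefficient⟧ (a * b) (A ⋆ᵗ B) ⟨
        ⟦ with-coefficient (a * b) (A ⋆ᵗ B) ⟧ˡ ∎
      row : ∀ M → (a ⊛ ⟦ A ⟧ᵗ) ⋆ ⟦ M ⟧ˡ ~ ⟦ rowᵗ M ⟧ˡ
      row []            = preserves-nil (⋆-linearʳ _)
      row ((b , B) ∷ M) = begin
        (a ⊛ ⟦ A ⟧ᵗ) ⋆ (b ⊛ ⟦ B ⟧ᵗ ⊕ ⟦ M ⟧ˡ)
          ≈⟨ additive (⋆-linearʳ _) _ _ ⟩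
        (a ⊛ ⟦ A ⟧ᵗ) ⋆ (b ⊛ ⟦ B ⟧ᵗ) ⊕ (a ⊛ ⟦ A ⟧ᵗ) ⋆ ⟦ M ⟧ˡ
          ≈⟨ ⊕-cong (term b B) (row M) ⟩
        ⟦ with-coefficient (a * b) (A ⋆ᵗ B) ⟧ˡ ⊕ ⟦ rowᵗ M ⟧ˡ
          ≈⟨ ⟦⟧ˡ-++ (with-coefficient (a * b) (A ⋆ᵗ B)) _ ⟨
        ⟦ rowᵗ ((b , B) ∷ M) ⟧ˡ ∎

  nf : Tm → LinComb
  nf gen     = [ (1# , tree nothing (single leaf)) ]
  nf nil     = []
  nf (s ⊕ t) = nf s ++ nf t
  nf (a ⊛ s) = scale a (nf s)
  nf (s ≺ t) = product _≺ᵗ_ (nf s) (nf t)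
  nf (s ⊚ t) = product _∘ᵗ_ (nf s) (nf t)
  nf (s ≻ t) = product _≻ᵗ_ (nf s) (nf t)

  nf-sound : ∀ t → t ~ ⟦ nf t ⟧ˡ
  nf-sound gen     = ~trans (~sym (⊛-one gen)) (s~s⊕nil _)
  nf-sound nil     = ~refl
  nf-sound (s ⊕ t) = ~trans (⊕-cong (nf-sound s) (nf-sound t)) (~sym (⟦⟧ˡ-++ (nf s) (nf t)))
  nf-sound (a ⊛ s) = ~trans (⊛-cong refl (nf-sound s)) (~sym (⟦⟧ˡ-scale a (nf s)))
  nf-sound (s ≺ t) = ~trans (≺-cong (nf-sound s) (nf-sound t))
                            (product-sound _≺_ _≺ᵗ_ ≺-linearˡ ≺-linearʳ ≺ᵗ-sound (nf s) (nf t))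
  nf-sound (s ⊚ t) = ~trans (⊚-cong (nf-sound s) (nf-sound t))
                            (product-sound _⊚_ _∘ᵗ_ ⊚-linearˡ ⊚-linearʳ ∘ᵗ-sound (nf s) (nf t))
  nf-sound (s ≻ t) = ~trans (≻-cong (nf-sound s) (nf-sound t))
                            (product-sound _≻_ _≻ᵗ_ ≻-linearˡ ≻-linearʳ ≻ᵗ-sound (nf s) (nf t))

module Support {c ℓ} (F : Field c ℓ) where
  open Field F
  open Construction F
  open Words F
  open Series F
  open NormalForm F using (⟦_⟧ᵗ; ⟦_⟧ᶜ; ⟦_⟧ᵃ)

  indicator : Bool → Carrier
  indicator b = when b 1#

  indicator-∧ : ∀ x y → indicator x * indicator y ≈ indicator (x ∧ y)
  indicator-∧ true  y = *-identityˡ _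
  indicator-∧ false y = zeroˡ _

  indicator-≈0 : ∀ b → ¬ T b → indicator b ≈ 0#
  indicator-≈0 false _  = refl
  indicator-≈0 true  ¬t = ⊥-elim (¬t tt)

  -- The length condition says that at most one split of w satisfies p.
  ∑-indicator-anySplit : ∀ p w n →
    (∀ u v → NonEmpty u → NonEmpty v → u ++ v ≡ w → T (p u v) → length u ≡ n) →
    ∑ (λ (u , v) → indicator (p u v)) (splits w) ≈ indicator (anySplit p w)
  ∑-indicator-anySplit p []          n unique = refl
  ∑-indicator-anySplit p (a ∷ [])    n unique = refl
  ∑-indicator-anySplit p (a ∷ b ∷ r) n unique =
    trans (∑-splits-∷ a (b ∷ r) tt _)
          (combine (p [ a ] (b ∷ r)) ≡.refl (∑-indicator-anySplit p′ (b ∷ r) (ℕ.pred n) unique′))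
    where
    p′ : Word → Word → Bool
    p′ u v = p (a ∷ u) v
    unique′ : ∀ u v → NonEmpty u → NonEmpty v → u ++ v ≡ b ∷ r → T (p′ u v) → length u ≡ ℕ.pred n
    unique′ u v _ v≢[] eq puv = ≡.cong ℕ.pred (unique (a ∷ u) v tt v≢[] (≡.cong (a ∷_) eq) puv)
    rest : Carrier
    rest = ∑ (λ (u , v) → indicator (p′ u v)) (splits (b ∷ r))
    combine : ∀ x → p [ a ] (b ∷ r) ≡ x → rest ≈ indicator (anySplit p′ (b ∷ r)) →
              indicator x + rest ≈ indicator (x ∨ anySplit p′ (b ∷ r))
    combine false _  rest≈ = trans (+-identityˡ _) rest≈
    combine true  eq _     = trans (+-congˡ rest≈0) (+-identityʳ _)
      where
      n≡1 : n ≡ 1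
      n≡1 = ≡.sym (unique [ a ] (b ∷ r) tt tt ≡.refl (≡.subst T (≡.sym eq) tt))
      too-long : ∀ {u v} → IsSplit (b ∷ r) (u , v) → ¬ T (p′ u v)
      too-long {u} {v} (eq′ , u≢[] , v≢[]) puv =
        ∷-nonEmpty-length a u u≢[] (≡.trans (unique (a ∷ u) v tt v≢[] (≡.cong (a ∷_) eq′) puv) n≡1)
      rest≈0 : rest ≈ 0#
      rest≈0 = trans (∑-congᴬ (splits (b ∷ r)) (splits-sound (b ∷ r))
                               (λ (u , v) split → indicator-≈0 (p′ u v) (too-long split)))
                     (∑-zero (splits (b ∷ r)) (λ _ → refl))

  mulWith-indicator : ∀ t {f g} p q → (∀ u → f u ≈ indicator (p u)) → (∀ v → g v ≈ indicator (q v)) →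
    ∀ w n → (∀ (fw : Factorisation t p q w) → length (left fw) ≡ n) →
    mulWith t f g w ≈ indicator (concatWith t p q w)
  mulWith-indicator t p q f≈ g≈ w n unique = trans
    (∑-cong (splits w) (λ (u , v) → let b = t (maxL u) (maxL v) in
      trans (when-cong b (trans (*-cong (f≈ u) (g≈ v)) (indicator-∧ (p u) (q v)))) (when-when b _ 1#)))
    (∑-indicator-anySplit _ w n (λ u v u≢[] v≢[] eq sat →
      unique (toFactorisation (split u≢[] v≢[] eq sat))))

  isLetter : Word → Bool
  isLetter (_ ∷ []) = true
  isLetter _        = false

  M₁-indicator : ∀ w → M₁ w ≈ indicator (isLetter w)
  M₁-indicator []          = refl
  M₁-indicator (_ ∷ [])    = refl
  M₁-indicator (_ ∷ _ ∷ _) = refl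

  mutual
    inTree : Tree → Word → Bool
    inTree (tree nothing  P) = inChain P
    inTree (tree (just A) P) = concatWith test≻ (inTree A) (inChain P)

    inChain : Chain → Word → Bool
    inChain (single Z) = inAtom Z
    inChain (Z ∘∷ P)   = concatWith test∘ (inAtom Z) (inChain P)

    inAtom : Atom → Word → Bool
    inAtom leaf      = isLetter
    inAtom (leaf≺ A) = concatWith test≺ isLetter (inTree A)

  atom-headIsStrictMax : ∀ Z {w} → T (inAtom Z w) → HeadIsStrictMax w
  atom-headIsStrictMax leaf {_ ∷ []} _ = []
  atom-headIsStrictMax (leaf≺ A) {w} h with concatWith-elim test≺ isLetter (inTree A) {w} h
  ... | factorisation {a ∷ []} {v} _ _ ≡.refl v<a _ _ =
    All.map (λ y≤ → ≤-<-trans y≤ (<ᵇ⇒< _ _ (≡.subst (λ m → T (maxL v <ᵇ m)) (⊔-identityʳ a) v<a)))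
            (≤-maxL v)

  chain-headIsMax : ∀ P {w} → T (inChain P w) → HeadIsMax w
  chain-headIsMax (single Z) h = strict⇒headIsMax (atom-headIsStrictMax Z h)
  chain-headIsMax (Z ∘∷ P) {w} h with concatWith-elim test∘ (inAtom Z) (inChain P) {w} h
  ... | factorisation {u} {v} _ _ ≡.refl u∘v zu pv =
    headIsMax-++ u v (atom-headIsStrictMax Z zu) (chain-headIsMax P pv) (≡ᵇ⇒≡ _ _ u∘v)

  tree-nonEmpty : ∀ A {w} → T (inTree A w) → NonEmpty w
  tree-nonEmpty (tree nothing P) {_ ∷ _} _ = tt
  tree-nonEmpty (tree nothing P) {[]}    h = chain-headIsMax P h
  tree-nonEmpty (tree (just A) P) {w} h with concatWith-elim test≻ (inTree A) (inChain P) {w} h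
  ... | factorisation {_ ∷ _} _ _ ≡.refl _ _ _ = tt

  ≺-factorisation-length : ∀ {q w} (f : Factorisation test≺ isLetter q w) → length (left f) ≡ 1
  ≺-factorisation-length (factorisation {_ ∷ []} _ _ _ _ _ _) = ≡.refl

  ∘-factorisation-length : ∀ Z P {w} (f : Factorisation test∘ (inAtom Z) (inChain P) w) →
                           length (left f) ≡ firstBlockLength w
  ∘-factorisation-length Z P (factorisation {u} {v} _ _ eq u∘v zu pv) =
    ∘-left-length u v eq (atom-headIsStrictMax Z zu) (chain-headIsMax P pv) (≡ᵇ⇒≡ _ _ u∘v)

  ≻-factorisation-length : ∀ {p} P {w} (f : Factorisation test≻ p (inChain P) w) →
                           length (left f) ≡ lengthBelow (maxL w) w
  ≻-factorisation-length P (factorisation {u} {v} _ _ eq u≻v _ pv) =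
    ≻-left-length u v eq u≻v (chain-headIsMax P pv)

  mutual
    φ-tree : ∀ A w → φ ⟦ A ⟧ᵗ w ≈ indicator (inTree A w)
    φ-tree (tree nothing  P) = φ-chain P
    φ-tree (tree (just A) P) w = mulWith-indicator test≻ (inTree A) (inChain P) (φ-tree A) (φ-chain P)
                                   w _ (≻-factorisation-length P)

    φ-chain : ∀ P w → φ ⟦ P ⟧ᶜ w ≈ indicator (inChain P w)
    φ-chain (single Z) = φ-atom Z
    φ-chain (Z ∘∷ P) w = mulWith-indicator test∘ (inAtom Z) (inChain P) (φ-atom Z) (φ-chain P)
                           w _ (∘-factorisation-length Z P)

    φ-atom : ∀ Z w → φ ⟦ Z ⟧ᵃ w ≈ indicator (inAtom Z w)
    φ-atom leaf      = M₁-indicator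
    φ-atom (leaf≺ A) w = mulWith-indicator test≺ isLetter (inTree A) M₁-indicator (φ-tree A)
                           w _ ≺-factorisation-length

  factors-agree : ∀ {t t′ p q p′ q′ w n} (f : Factorisation t p q w) (f′ : Factorisation t′ p′ q′ w) →
                  length (left f) ≡ n → length (left f′) ≡ n → T (p′ (left f)) × T (q′ (right f))
  factors-agree (factorisation {u} {v} _ _ eq _ _ _) (factorisation {u′} {v′} _ _ eq′ _ pu′ qv′) len len′
    with ++-split-unique u v u′ v′ (≡.trans eq (≡.sym eq′)) (≡.trans len (≡.sym len′))
  ... | ≡.refl , ≡.refl = pu′ , qv′

  chain∩≻-empty : ∀ P A Q {w} → T (inChain P w) → ¬ T (inTree (tree (just A) Q) w)
  chain∩≻-empty P A Q {w} pw h
    with chain-headIsMax P pw | concatWith-elim test≻ (inTree A) (inChain Q) {w} h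
  ... | rest≤x | factorisation {x ∷ u} {v} _ _ ≡.refl u≻v _ _ = <-irrefl ≡.refl x<x
    where
    maxL-v≤x : maxL v ≤ x
    maxL-v≤x = ≡.subst (maxL v ≤_) (≡.trans (≡.sym (maxL-++ (x ∷ u) v)) (maxL-headIsMax x (u ++ v) rest≤x))
                       (m≤n⊔m (maxL (x ∷ u)) (maxL v))
    x<x : x < x
    x<x = ≤-<-trans (m≤m⊔n x (maxL u)) (<-≤-trans (<ᵇ⇒< _ _ u≻v) maxL-v≤x)

  atom∩∘-empty : ∀ Z Z′ Q {w} → T (inAtom Z w) → ¬ T (inChain (Z′ ∘∷ Q) w)
  atom∩∘-empty Z Z′ Q {w} zw h
    with atom-headIsStrictMax Z zw | concatWith-elim test∘ (inAtom Z′) (inChain Q) {w} h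
  ... | rest<x | factorisation {x ∷ u} {b ∷ t} _ _ ≡.refl u∘v zu qv
    with heads-agree (atom-headIsStrictMax Z′ zu) (chain-headIsMax Q qv) (≡ᵇ⇒≡ _ _ u∘v)
  ...   | ≡.refl with All.++⁻ʳ u rest<x
  ...     | x<x ∷ _ = <-irrefl ≡.refl x<x

  letter∩≺-empty : ∀ A {w} → T (isLetter w) → ¬ T (inAtom (leaf≺ A) w)
  letter∩≺-empty A {w} lw h with concatWith-elim test≺ isLetter (inTree A) {w} h
  ... | factorisation {_ ∷ []} {_ ∷ _} _ _ ≡.refl _ _ _ = lw

  mutual
    inTree-unique : ∀ A B {w} → T (inTree A w) → T (inTree B w) → A ≡ B
    inTree-unique (tree nothing  P) (tree nothing  Q) pw qw = ≡.cong (tree nothing) (inChain-unique P Q pw qw)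
    inTree-unique (tree nothing  P) (tree (just B) Q) pw qw = ⊥-elim (chain∩≻-empty P B Q pw qw)
    inTree-unique (tree (just A) P) (tree nothing  Q) pw qw = ⊥-elim (chain∩≻-empty Q A P qw pw)
    inTree-unique (tree (just A) P) (tree (just B) Q) {w} pw qw
      with f ← concatWith-elim test≻ (inTree A) (inChain P) {w} pw
         | f′ ← concatWith-elim test≻ (inTree B) (inChain Q) {w} qw
      with bu , qv ← factors-agree f f′ (≻-factorisation-length P f) (≻-factorisation-length Q f′)
      = ≡.cong₂ (λ X Y → tree (just X) Y)
                (inTree-unique A B (left-in f) bu) (inChain-unique P Q (right-in f) qv)

    inChain-unique : ∀ P Q {w} → T (inChain P w) → T (inChain Q w) → P ≡ Q
    inChain-unique (single Z) (single Z′) pw qw = ≡.cong single (inAtom-unique Z Z′ pw qw)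
    inChain-unique (single Z) (Z′ ∘∷ Q)   pw qw = ⊥-elim (atom∩∘-empty Z Z′ Q pw qw)
    inChain-unique (Z ∘∷ P)   (single Z′) pw qw = ⊥-elim (atom∩∘-empty Z′ Z P qw pw)
    inChain-unique (Z ∘∷ P)   (Z′ ∘∷ Q)   {w} pw qw
      with f ← concatWith-elim test∘ (inAtom Z) (inChain P) {w} pw
         | f′ ← concatWith-elim test∘ (inAtom Z′) (inChain Q) {w} qw
      with z′u , qv ← factors-agree f f′ (∘-factorisation-length Z P f) (∘-factorisation-length Z′ Q f′)
      = ≡.cong₂ _∘∷_ (inAtom-unique Z Z′ (left-in f) z′u) (inChain-unique P Q (right-in f) qv)

    inAtom-unique : ∀ Z Z′ {w} → T (inAtom Z w) → T (inAtom Z′ w) → Z ≡ Z′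
    inAtom-unique leaf      leaf      _  _  = ≡.refl
    inAtom-unique leaf      (leaf≺ B) pw qw = ⊥-elim (letter∩≺-empty B pw qw)
    inAtom-unique (leaf≺ A) leaf      pw qw = ⊥-elim (letter∩≺-empty A qw pw)
    inAtom-unique (leaf≺ A) (leaf≺ B) {w} pw qw
      with f ← concatWith-elim test≺ isLetter (inTree A) {w} pw
         | f′ ← concatWith-elim test≺ isLetter (inTree B) {w} qw
      with _ , bv ← factors-agree f f′ (≺-factorisation-length f) (≺-factorisation-length f′)
      = ≡.cong leaf≺_ (inTree-unique A B (right-in f) bv)

  mutual
    heightᵗ : Tree → ℕ
    heightᵗ (tree nothing  P) = heightᶜ P
    heightᵗ (tree (just A) P) = suc (heightᵗ A) ⊔ⁿ heightᶜ P

    heightᶜ : Chain → ℕ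
    heightᶜ (single Z) = heightᵃ Z
    heightᶜ (Z ∘∷ P)   = heightᵃ Z ⊔ⁿ heightᶜ P

    heightᵃ : Atom → ℕ
    heightᵃ leaf      = 0
    heightᵃ (leaf≺ A) = suc (heightᵗ A)

  -- A word in the support whose largest letter is any prescribed n ≥ height.
  mutual
    witnessᵗ : Tree → ℕ → Word
    witnessᵗ (tree nothing  P) n = witnessᶜ P n
    witnessᵗ (tree (just A) P) n = witnessᵗ A (ℕ.pred n) ++ witnessᶜ P n

    witnessᶜ : Chain → ℕ → Word
    witnessᶜ (single Z) n = witnessᵃ Z n
    witnessᶜ (Z ∘∷ P)   n = witnessᵃ Z n ++ witnessᶜ P n

    witnessᵃ : Atom → ℕ → Word
    witnessᵃ leaf      n = [ n ]
    witnessᵃ (leaf≺ A) n = n ∷ witnessᵗ A (ℕ.pred n)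

  Witness : (Word → Bool) → Word → ℕ → Set
  Witness p w n = T (p w) × maxL w ≡ n

  mutual
    witnessᵗ-valid : ∀ A n → heightᵗ A ≤ n → Witness (inTree A) (witnessᵗ A n) n
    witnessᵗ-valid (tree nothing  P) n h = witnessᶜ-valid P n h
    witnessᵗ-valid (tree (just A) P) n h =
      ≻-case n (m⊔n≤o⇒m≤o (suc (heightᵗ A)) (heightᶜ P) h)
               (witnessᶜ-valid P n (m⊔n≤o⇒n≤o (suc (heightᵗ A)) (heightᶜ P) h))
      where
      ≻-case : ∀ n → suc (heightᵗ A) ≤ n → Witness (inChain P) (witnessᶜ P n) n →
               Witness (inTree (tree (just A) P)) (witnessᵗ (tree (just A) P) n) n
      ≻-case (suc k) (s≤s hA≤k) (p∈ , max-v) with witnessᵗ-valid A k hA≤k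
      ... | a∈ , max-u =
        concatWith-intro test≻ (inTree A) (inChain P) (tree-nonEmpty A a∈) (tree-nonEmpty (tree nothing P) p∈)
          (≡.subst₂ (λ x y → T (x <ᵇ y)) (≡.sym max-u) (≡.sym max-v) (<⇒<ᵇ (n<1+n k))) a∈ p∈
        , ≡.trans (maxL-++ (witnessᵗ A k) _)
                  (≡.trans (≡.cong₂ _⊔ⁿ_ max-u max-v) (m≤n⇒m⊔n≡n (n≤1+n k)))

    witnessᶜ-valid : ∀ P n → heightᶜ P ≤ n → Witness (inChain P) (witnessᶜ P n) n
    witnessᶜ-valid (single Z) n h = witnessᵃ-valid Z n h
    witnessᶜ-valid (Z ∘∷ P)   n h
      with witnessᵃ-valid Z n (m⊔n≤o⇒m≤o (heightᵃ Z) (heightᶜ P) h)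
         | witnessᶜ-valid P n (m⊔n≤o⇒n≤o (heightᵃ Z) (heightᶜ P) h)
    ... | z∈ , max-u | p∈ , max-v =
      concatWith-intro test∘ (inAtom Z) (inChain P)
        (strict⇒nonEmpty (atom-headIsStrictMax Z z∈)) (tree-nonEmpty (tree nothing P) p∈)
        (≡.subst₂ (λ x y → T (x ≡ᵇ y)) (≡.sym max-u) (≡.sym max-v) (≡⇒≡ᵇ n n ≡.refl)) z∈ p∈
      , ≡.trans (maxL-++ (witnessᵃ Z n) _) (≡.trans (≡.cong₂ _⊔ⁿ_ max-u max-v) (⊔-idem n))

    witnessᵃ-valid : ∀ Z n → heightᵃ Z ≤ n → Witness (inAtom Z) (witnessᵃ Z n) n
    witnessᵃ-valid leaf      n       _          = tt , ⊔-identityʳ n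
    witnessᵃ-valid (leaf≺ A) (suc k) (s≤s hA≤k) with witnessᵗ-valid A k hA≤k
    ... | a∈ , max-v =
      concatWith-intro test≺ isLetter (inTree A) {[ suc k ]} tt (tree-nonEmpty A a∈)
        (≡.subst (λ y → T (y <ᵇ suc k)) (≡.sym max-v) (<⇒<ᵇ (n<1+n k))) tt a∈
      , ≡.trans (≡.cong (suc k ⊔ⁿ_) max-v) (m≥n⇒m⊔n≡m (n≤1+n k))

  witness : Tree → Word
  witness A = witnessᵗ A (heightᵗ A)

  witness-valid : ∀ A → T (inTree A (witness A))
  witness-valid A = proj₁ (witnessᵗ-valid A (heightᵗ A) ≤-refl)

module Freeness {c ℓ} (F : Field c ℓ) where
  open Field F
  open Construction F
  open Series F using (∑; ∑-cong; when; when-*ˡ; mulWith-cong; φ-cong; *-∑)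
  open NormalForm F
  open Support F
  open RingProperties ring using (-1*x≈-x)

  -- Decided by membership of the witness, which lies in the support of exactly one tree.
  _≟ᵗ_ : DecidableEquality Tree
  A ≟ᵗ B = map′ (λ A∋wB → inTree-unique A B A∋wB (witness-valid B)) (λ { ≡.refl → witness-valid B })
                (T? (inTree A (witness B)))

  coefficient : Tree → LinComb → Carrier
  coefficient A = ∑ (λ (a , B) → when (does (B ≟ᵗ A)) a)

  *-indicator : ∀ a b → a * indicator b ≈ when b a
  *-indicator a true  = *-identityʳ a
  *-indicator a false = zeroʳ a

  φ-at-witness : ∀ A L → φ ⟦ L ⟧ˡ (witness A) ≈ coefficient A L
  φ-at-witness A []            = refl
  φ-at-witness A ((a , B) ∷ L) =
    +-cong (trans (*-congˡ (φ-tree B (witness A))) (*-indicator a _)) (φ-at-witness A L)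

  coefficient-nf : ∀ A t → coefficient A (nf t) ≈ φ t (witness A)
  coefficient-nf A t = trans (sym (φ-at-witness A (nf t))) (sym (φ-cong _ _ (nf-sound t) (witness A)))

  coefficient-++ : ∀ A L M → coefficient A (L ++ M) ≈ coefficient A L + coefficient A M
  coefficient-++ A []      M = sym (+-identityˡ _)
  coefficient-++ A (p ∷ L) M = trans (+-congˡ (coefficient-++ A L M)) (sym (+-assoc _ _ _))

  coefficient-scale : ∀ A a L → coefficient A (scale a L) ≈ a * coefficient A L
  coefficient-scale A a L = trans (reflexive (≡.cong sumK (≡.sym (map-∘ L))))
    (trans (∑-cong L (λ (b , B) → when-*ˡ (does (B ≟ᵗ A)) a b)) (sym (*-∑ a _ L)))

  without : Tree → LinComb → LinComb
  without A = filter (λ (_ , B) → ¬? (B ≟ᵗ A))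

  without-head : ∀ A a L → without A ((a , A) ∷ L) ≡ without A L
  without-head A a L = filter-reject (λ (_ , B) → ¬? (B ≟ᵗ A)) (λ A≢A → A≢A ≡.refl)

  collect : ∀ A L → ⟦ L ⟧ˡ ~ coefficient A L ⊛ ⟦ A ⟧ᵗ ⊕ ⟦ without A L ⟧ˡ
  collect A [] = ~sym (~trans (⊕-cong (⊛-zero _) ~refl) (⊕-idˡ nil))
  collect A ((a , B) ∷ L) with B ≟ᵗ A
  ... | yes ≡.refl = begin
    a ⊛ ⟦ A ⟧ᵗ ⊕ ⟦ L ⟧ˡ                                       ≈⟨ ⊕-cong ~refl (collect A L) ⟩
    a ⊛ ⟦ A ⟧ᵗ ⊕ (coefficient A L ⊛ ⟦ A ⟧ᵗ ⊕ ⟦ without A L ⟧ˡ)  ≈⟨ ⊕-assoc _ _ _ ⟨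
    (a ⊛ ⟦ A ⟧ᵗ ⊕ coefficient A L ⊛ ⟦ A ⟧ᵗ) ⊕ ⟦ without A L ⟧ˡ ≈⟨ ⊕-cong (⊛-distˡ _ _ _) ~refl ⟨
    (a + coefficient A L) ⊛ ⟦ A ⟧ᵗ ⊕ ⟦ without A L ⟧ˡ
      ≈⟨ ⊕-cong (⊛-cong (+-congʳ a≈) ~refl) (≡⇒~ (≡.cong ⟦_⟧ˡ (without-head A a L))) ⟨
    coefficient A ((a , A) ∷ L) ⊛ ⟦ A ⟧ᵗ ⊕ ⟦ without A ((a , A) ∷ L) ⟧ˡ ∎
    where
    open SetoidReasoning ~-setoid
    a≈ : when (does (A ≟ᵗ A)) a ≈ a
    a≈ = reflexive (≡.cong (λ b → when b a) (dec-true (A ≟ᵗ A) ≡.refl))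
  ... | no B≢A = begin
    a ⊛ ⟦ B ⟧ᵗ ⊕ ⟦ L ⟧ˡ                                       ≈⟨ ⊕-cong ~refl (collect A L) ⟩
    a ⊛ ⟦ B ⟧ᵗ ⊕ (coefficient A L ⊛ ⟦ A ⟧ᵗ ⊕ ⟦ without A L ⟧ˡ)  ≈⟨ ⊕-assoc _ _ _ ⟨
    (a ⊛ ⟦ B ⟧ᵗ ⊕ coefficient A L ⊛ ⟦ A ⟧ᵗ) ⊕ ⟦ without A L ⟧ˡ ≈⟨ ⊕-cong (⊕-comm _ _) ~refl ⟩
    (coefficient A L ⊛ ⟦ A ⟧ᵗ ⊕ a ⊛ ⟦ B ⟧ᵗ) ⊕ ⟦ without A L ⟧ˡ ≈⟨ ⊕-assoc _ _ _ ⟩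
    coefficient A L ⊛ ⟦ A ⟧ᵗ ⊕ (a ⊛ ⟦ B ⟧ᵗ ⊕ ⟦ without A L ⟧ˡ)
      ≈⟨ ⊕-cong (⊛-cong 0+c≈c ~refl) (≡⇒~ (≡.cong ⟦_⟧ˡ kept)) ⟨
    coefficient A ((a , B) ∷ L) ⊛ ⟦ A ⟧ᵗ ⊕ ⟦ without A ((a , B) ∷ L) ⟧ˡ ∎
    where
    open SetoidReasoning ~-setoid
    0+c≈c : when (does (B ≟ᵗ A)) a + coefficient A L ≈ coefficient A L
    0+c≈c = trans (+-congʳ (reflexive (≡.cong (λ b → when b a) (dec-false (B ≟ᵗ A) B≢A)))) (+-identityˡ _)
    kept : without A ((a , B) ∷ L) ≡ (a , B) ∷ without A L
    kept = filter-accept (λ (_ , B) → ¬? (B ≟ᵗ A)) B≢A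

  coefficient-without-self : ∀ A L → coefficient A (without A L) ≈ 0#
  coefficient-without-self A []            = refl
  coefficient-without-self A ((a , B) ∷ L) with B ≟ᵗ A
  ... | yes ≡.refl = trans (reflexive (≡.cong (coefficient A) (without-head A a L))) (coefficient-without-self A L)
  ... | no B≢A     = begin
    coefficient A (without A ((a , B) ∷ L))
      ≡⟨ ≡.cong (coefficient A) (filter-accept (λ (_ , B) → ¬? (B ≟ᵗ A)) B≢A) ⟩
    when (does (B ≟ᵗ A)) a + coefficient A (without A L)
      ≡⟨ ≡.cong (λ b → when b a + coefficient A (without A L)) (dec-false (B ≟ᵗ A) B≢A) ⟩
    0# + coefficient A (without A L)
      ≈⟨ +-identityˡ _ ⟩
    coefficient A (without A L)
      ≈⟨ coefficient-without-self A L ⟩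
    0# ∎
    where open SetoidReasoning setoid

  coefficient-without-other : ∀ A B L → ¬ B ≡ A → coefficient B (without A L) ≈ coefficient B L
  coefficient-without-other A B []            _   = refl
  coefficient-without-other A B ((a , C) ∷ L) B≢A with C ≟ᵗ A
  ... | yes ≡.refl = begin
    coefficient B (without C ((a , C) ∷ L)) ≡⟨ ≡.cong (coefficient B) (without-head C a L) ⟩
    coefficient B (without C L)             ≈⟨ coefficient-without-other C B L B≢A ⟩
    coefficient B L                         ≈⟨ +-identityˡ _ ⟨
    0# + coefficient B L
      ≡⟨ ≡.cong (λ b → when b a + coefficient B L) (dec-false (C ≟ᵗ B) C≢B) ⟨
    coefficient B ((a , C) ∷ L)             ∎
    where
    open SetoidReasoning setoid
    C≢B : ¬ C ≡ B
    C≢B C≡B = B≢A (≡.sym C≡B)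
  ... | no C≢A = trans (reflexive (≡.cong (coefficient B) (filter-accept (λ (_ , B) → ¬? (B ≟ᵗ A)) C≢A)))
                       (+-congˡ (coefficient-without-other A B L B≢A))

  -- Collecting the occurrences of one tree leaves a shorter combination.
  coefficients≈0⇒nil : ∀ n L → length L ≤ n → (∀ A → coefficient A L ≈ 0#) → ⟦ L ⟧ˡ ~ nil
  coefficients≈0⇒nil n       []              _         _      = ~refl
  coefficients≈0⇒nil (suc n) L@((a , A) ∷ L′) (s≤s |L′|≤n) zeros = begin
    ⟦ L ⟧ˡ                                       ≈⟨ collect A L ⟩
    coefficient A L ⊛ ⟦ A ⟧ᵗ ⊕ ⟦ without A L ⟧ˡ  ≈⟨ ⊕-cong (⊛-cong (zeros A) ~refl) rest~nil ⟩
    0# ⊛ ⟦ A ⟧ᵗ ⊕ nil                             ≈⟨ ⊕-idʳ _ ⟩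
    0# ⊛ ⟦ A ⟧ᵗ                                   ≈⟨ ⊛-zero _ ⟩
    nil                                          ∎
    where
    open SetoidReasoning ~-setoid
    shorter : length (without A L) ≤ n
    shorter = ≡.subst (λ M → length M ≤ n) (≡.sym (without-head A a L′))
                      (≤-trans (length-filter (λ (_ , B) → ¬? (B ≟ᵗ A)) L′) |L′|≤n)
    zeros′ : ∀ B → coefficient B (without A L) ≈ 0#
    zeros′ B with B ≟ᵗ A
    ... | yes ≡.refl = coefficient-without-self B L
    ... | no B≢A     = trans (coefficient-without-other A B L B≢A) (zeros B)
    rest~nil : ⟦ without A L ⟧ˡ ~ nil
    rest~nil = coefficients≈0⇒nil n (without A L) shorter zeros′

  difference-nil⇒~ : ∀ {s t} → s ⊕ (- 1#) ⊛ t ~ nil → s ~ t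
  difference-nil⇒~ {s} {t} s-t~nil = begin
    s                         ≈⟨ ⊕-idʳ s ⟨
    s ⊕ nil                   ≈⟨ ⊕-cong ~refl (⊕-inv t) ⟨
    s ⊕ ((- 1#) ⊛ t ⊕ t)      ≈⟨ ⊕-assoc _ _ _ ⟨
    (s ⊕ (- 1#) ⊛ t) ⊕ t      ≈⟨ ⊕-cong s-t~nil ~refl ⟩
    nil ⊕ t                   ≈⟨ ⊕-idˡ t ⟩
    t                         ∎
    where open SetoidReasoning ~-setoid

  -- Coefficients are read off at witnesses, so φ s ≐ φ t forces nf s and nf t to agree.
  φ-injective : ∀ s t → φ s ≐ φ t → s ~ t
  φ-injective s t φs≐φt = difference-nil⇒~ (begin
    s ⊕ (- 1#) ⊛ t                        ≈⟨ ⊕-cong (nf-sound s) (⊛-cong refl (nf-sound t)) ⟩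
    ⟦ nf s ⟧ˡ ⊕ (- 1#) ⊛ ⟦ nf t ⟧ˡ        ≈⟨ ⊕-cong ~refl (⟦⟧ˡ-scale (- 1#) (nf t)) ⟨
    ⟦ nf s ⟧ˡ ⊕ ⟦ scale (- 1#) (nf t) ⟧ˡ  ≈⟨ ⟦⟧ˡ-++ (nf s) _ ⟨
    ⟦ difference ⟧ˡ                       ≈⟨ coefficients≈0⇒nil _ difference ≤-refl zeros ⟩
    nil                                   ∎)
    where
    open SetoidReasoning ~-setoid
    difference : LinComb
    difference = nf s ++ scale (- 1#) (nf t)
    zeros : ∀ A → coefficient A difference ≈ 0#
    zeros A = trans (coefficient-++ A (nf s) _) (trans (+-cong same (coefficient-scale A (- 1#) (nf t)))
                (trans (+-congˡ (-1*x≈-x _)) (-‿inverseʳ _)))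
      where
      same : coefficient A (nf s) ≈ coefficient A (nf t)
      same = trans (coefficient-nf A s) (trans (φs≐φt (witness A)) (sym (coefficient-nf A t)))

  φ-in𝔗 : ∀ t → In𝔗 (φ t)
  φ-in𝔗 gen     = 𝔗-M₁
  φ-in𝔗 nil     = 𝔗-zero
  φ-in𝔗 (s ⊕ t) = 𝔗-⊕ (φ-in𝔗 s) (φ-in𝔗 t)
  φ-in𝔗 (a ⊛ s) = 𝔗-⊛ a (φ-in𝔗 s)
  φ-in𝔗 (s ≺ t) = 𝔗-≺ (φ-in𝔗 s) (φ-in𝔗 t)
  φ-in𝔗 (s ⊚ t) = 𝔗-⊚ (φ-in𝔗 s) (φ-in𝔗 t)
  φ-in𝔗 (s ≻ t) = 𝔗-≻ (φ-in𝔗 s) (φ-in𝔗 t)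

  In𝔗⇒image : ∀ f → In𝔗 f → ∃ λ t → φ t ≐ f
  In𝔗⇒image _ 𝔗-M₁             = gen , λ _ → refl
  In𝔗⇒image _ 𝔗-zero           = nil , λ _ → refl
  In𝔗⇒image _ (𝔗-⊕ f∈ g∈)      with In𝔗⇒image _ f∈ | In𝔗⇒image _ g∈
  ... | s , φs≐f | t , φt≐g = s ⊕ t , λ w → +-cong (φs≐f w) (φt≐g w)
  In𝔗⇒image _ (𝔗-⊛ a f∈)       with In𝔗⇒image _ f∈
  ... | s , φs≐f = a ⊛ s , λ w → *-congˡ (φs≐f w)
  In𝔗⇒image _ (𝔗-≺ f∈ g∈)      with In𝔗⇒image _ f∈ | In𝔗⇒image _ g∈
  ... | s , φs≐f | t , φt≐g = s ≺ t , mulWith-cong test≺ φs≐f φt≐g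
  In𝔗⇒image _ (𝔗-⊚ f∈ g∈)      with In𝔗⇒image _ f∈ | In𝔗⇒image _ g∈
  ... | s , φs≐f | t , φt≐g = s ⊚ t , mulWith-cong test∘ φs≐f φt≐g
  In𝔗⇒image _ (𝔗-≻ f∈ g∈)      with In𝔗⇒image _ f∈ | In𝔗⇒image _ g∈
  ... | s , φs≐f | t , φt≐g = s ≻ t , mulWith-cong test≻ φs≐f φt≐g
  In𝔗⇒image _ (𝔗-resp f≐g f∈) with In𝔗⇒image _ f∈
  ... | s , φs≐f = s , λ w → trans (φs≐f w) (f≐g w)

mainTheorem2 : ∀ {c ℓ} (F : Field c ℓ) → CharZero F →
    let open Construction F in
      -- φ is well defined on the free trialgebra (respects its relations)
      (∀ s t → s ~ t → φ s ≐ φ t)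
      -- φ lands in 𝔗
      × (∀ t → In𝔗 (φ t))
      -- φ is injective
      × (∀ s t → φ s ≐ φ t → s ~ t)
      -- φ is surjective onto 𝔗
      × (∀ f → In𝔗 f → ∃ λ t → φ t ≐ f)
mainTheorem2 F _ = φ-cong , φ-in𝔗 , φ-injective , In𝔗⇒image
  where
  open Series F using (φ-cong)
  open Freeness F
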